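{- Let $1\le m\le n$. The involution $\iota:(X,Y)\mapsto(\gamma_m Y^T\gamma_n,\ \gamma_n X^T\gamma_m)$ of $\mathrm{Mat}(m,n,\mathbb C)\times\mathrm{Mat}(n,m,\mathbb C)$ preserves $E$, and for each $\pi\in\mathfrak S_{m,n}$ it sends $E_\pi$ to $E_{\gamma_n\circ\pi\circ\gamma_m}$.
   Context: $\mathfrak S_{m,n}$ is the set of injective maps $\pi:\{1,\dots,m\}\to\{1,\dots,n\}$, identified with the $m\times n$ partial permutation matrix with $\pi_{ij}=1$ iff $\pi(i)=j$. $\gamma_k$ denotes the permutation $i\mapsto k+1-i$ of $\{1,\dots,k\}$, and also its $k\times k$ permutation matrix. $E=\{(X,Y)\in\mathrm{Mat}(m,n,\mathbb C)\times\mathrm{Mat}(n,m,\mathbb C): XY \text{ lower triangular},\ YX\text{ upper triangular}\}$. $B_-$ (resp. $B_+$) is the group of invertible lower triangular $m\times m$ (resp. upper triangular $n\times n$) matrices; $E_\pi$ is the closure of $\{(X,Y)\in E: X\in B_-\pi B_+\}$. -}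

module Defs where

open import Level using (Level; _⊔_) renaming (suc to lsuc)
open import Algebra.Bundles using (CommutativeRing)
open import Data.Nat using (ℕ; zero; suc; _<_)
open import Data.Fin using (Fin; toℕ; opposite; _≟_)
open import Data.Fin.Properties using (opposite-involutive)
open import Data.Product using (_×_; _,_; ∃; Σ-syntax; proj₁; proj₂)
open import Data.Sum using (_⊎_; inj₁; inj₂)
open import Function using (_∘_)
open import Function.Definitions using (Injective)
open import Relation.Nullary using (¬_; yes; no)
open import Relation.Binary.PropositionalEquality using (_≡_; refl; sym; trans; cong)

-- Algebraically closed fields of characteristic zero (stand-in for ℂ)

module RingOps {c ℓ : Level} (R : CommutativeRing c ℓ) where
  open CommutativeRing R

  natEmb : ℕ → Carrier
  natEmb zero    = 0#
  natEmb (suc k) = 1# + natEmb k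

  pow : Carrier → ℕ → Carrier
  pow x zero    = 1#
  pow x (suc k) = x * pow x k

  sumF : ∀ k → (Fin k → Carrier) → Carrier
  sumF zero    f = 0#
  sumF (suc k) f = f Fin.zero + sumF k (f ∘ Fin.suc)

record ACF0 (c ℓ : Level) : Set (lsuc (c ⊔ ℓ)) where
  field
    cring : CommutativeRing c ℓ
  open CommutativeRing cring public
  open RingOps cring public
  field
    one≉zero  : ¬ (1# ≈ 0#)
    inverses  : ∀ x → ¬ (x ≈ 0#) → ∃ λ y → x * y ≈ 1#
    char0     : ∀ k → ¬ (natEmb (suc k) ≈ 0#)
    algClosed : ∀ k (a : Fin (suc k) → Carrier) →
                ∃ λ x → pow x (suc k) + sumF (suc k) (λ i → a i * pow x (toℕ i)) ≈ 0#

module _ {c ℓ : Level} (K : ACF0 c ℓ) where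
  open ACF0 K

  Mat : ℕ → ℕ → Set c
  Mat m n = Fin m → Fin n → Carrier

  _≈ₘ_ : ∀ {m n} → Mat m n → Mat m n → Set ℓ
  A ≈ₘ B = ∀ i j → A i j ≈ B i j

  _·_ : ∀ {m n k} → Mat m n → Mat n k → Mat m k
  _·_ {n = n} A B i j = sumF n (λ l → A i l * B l j)

  transpose : ∀ {m n} → Mat m n → Mat n m
  transpose A i j = A j i

  idMat : ∀ n → Mat n n
  idMat n i j with i ≟ j
  ... | yes _ = 1#
  ... | no  _ = 0#

  -- the permutation matrix of γ_k : i ↦ k+1-i (0-indexed: i ↦ k-1-i)
  γMat : ∀ k → Mat k k
  γMat k i j with opposite i ≟ j
  ... | yes _ = 1#
  ... | no  _ = 0#

  LowerTri : ∀ {n} → Mat n n → Set ℓ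
  LowerTri A = ∀ i j → toℕ i < toℕ j → A i j ≈ 0#

  UpperTri : ∀ {n} → Mat n n → Set ℓ
  UpperTri A = ∀ i j → toℕ j < toℕ i → A i j ≈ 0#

  Invertible : ∀ {n} → Mat n n → Set (c ⊔ ℓ)
  Invertible {n} A = ∃ λ B → ((A · B) ≈ₘ idMat n) × ((B · A) ≈ₘ idMat n)

  InBminus : ∀ {m} → Mat m m → Set (c ⊔ ℓ)
  InBminus A = LowerTri A × Invertible A

  InBplus : ∀ {n} → Mat n n → Set (c ⊔ ℓ)
  InBplus A = UpperTri A × Invertible A

  Pt : ℕ → ℕ → Set c
  Pt m n = Mat m n × Mat n m

  _≈ₚ_ : ∀ {m n} → Pt m n → Pt m n → Set ℓ
  (X , Y) ≈ₚ (X' , Y') = (X ≈ₘ X') × (Y ≈ₘ Y')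

  InE : ∀ {m n} → Pt m n → Set ℓ
  InE (X , Y) = LowerTri (X · Y) × UpperTri (Y · X)

  ι : ∀ {m n} → Pt m n → Pt m n
  ι {m} {n} (X , Y) = ((γMat m · transpose Y) · γMat n) , ((γMat n · transpose X) · γMat m)

  data Poly (m n : ℕ) : Set c where
    varX : Fin m → Fin n → Poly m n
    varY : Fin n → Fin m → Poly m n
    con  : Carrier → Poly m n
    _⊕_  : Poly m n → Poly m n → Poly m n
    _⊗_  : Poly m n → Poly m n → Poly m n
    ⊝_   : Poly m n → Poly m n

  eval : ∀ {m n} → Poly m n → Pt m n → Carrier
  eval (varX i j) (X , Y) = X i j
  eval (varY i j) (X , Y) = Y i j
  eval (con a)    p       = a
  eval (f ⊕ g)    p       = eval f p + eval g p
  eval (f ⊗ g)    p       = eval f p * eval g p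
  eval (⊝ f)      p       = - eval f p

  Closure : ∀ {m n} {s} → (Pt m n → Set s) → Pt m n → Set (c ⊔ ℓ ⊔ s)
  Closure {m} {n} S p = ∀ (f : Poly m n) → (∀ q → S q → eval f q ≈ 0#) → eval f p ≈ 0#

record PPerm (m n : ℕ) : Set where
  field
    fun : Fin m → Fin n
    inj : Injective _≡_ _≡_ fun
open PPerm public

opposite-injective : ∀ {k} → Injective {A = Fin k} _≡_ _≡_ opposite
opposite-injective {x = a} {y = b} e =
  trans (sym (opposite-involutive a)) (trans (cong opposite e) (opposite-involutive b))

γπγ : ∀ {m n} → PPerm m n → PPerm m n
γπγ π = record
  { fun = opposite ∘ fun π ∘ opposite
  ; inj = λ e → opposite-injective (inj π (opposite-injective e)) }

module _ {c ℓ : Level} (K : ACF0 c ℓ) where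
  open ACF0 K

  permMat : ∀ {m n} → PPerm m n → Mat K m n
  permMat π i j with fun π i ≟ j
  ... | yes _ = 1#
  ... | no  _ = 0#

  InCell : ∀ {m n} → PPerm m n → Mat K m n → Set (c ⊔ ℓ)
  InCell {m} {n} π X = Σ[ b ∈ Mat K m m ] Σ[ u ∈ Mat K n n ]
    (InBminus K b × InBplus K u × _≈ₘ_ K X (_·_ K (_·_ K b (permMat π)) u))

  InEπ : ∀ {m n} → PPerm m n → Pt K m n → Set (c ⊔ ℓ)
  InEπ π = Closure K (λ p → InE K p × InCell π (proj₁ p))

-- Write Ã = γ Aᵀ γ for the antitranspose. Then ι(X,Y) = (Ỹ, X̃), and since (AB)~ = B̃ Ã while
-- ~ preserves lower and upper triangularity, ι is an involution of E. It pulls polynomials back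
-- to polynomials, so it suffices to show that ι maps {(X,Y) ∈ E : X ∈ B₋πB₊} into E_ρ, ρ = γπγ;
-- there the second coordinate X̃ lies in B₊ σᵀ B₋, with σ the matrix of ρ.
--
-- So let (X,Y) ∈ E with Y = u σᵀ b, u ∈ B₊, b ∈ B₋, and put W = b X u. Then L = W σᵀ is lower and
-- σᵀ W upper triangular. Replacing the diagonal of L by variables a gives B(a); with R = W − L σ,
-- so that R σᵀ = 0, the family W(a) = B(a) σ + R passes through W at a = diag L. On the torus
-- (all aᵢ ≠ 0), B(a) is invertible and its inverse keeps the support {k ≤ i, ρ(i) ≤ ρ(k)} of L,
-- which makes N = σᵀ B(a)⁻¹ R upper triangular with N² = 0; hence W(a) = B(a) σ (1 + N) lies in
-- B₋ σ B₊, and (b⁻¹ W(a) u⁻¹, Y) stays in E. A polynomial vanishing on the torus vanishes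
-- everywhere (K is infinite, having characteristic 0), so the point at a = diag L lies in E_ρ.

module Submission where

open import Defs
open import Level using (Level; _⊔_)
open import Algebra.Bundles using (CommutativeRing)
open import Data.Nat as ℕ using (ℕ; zero; suc; _≤_; _<_; z≤n; s≤s)
import Data.Nat.Properties as ℕ
open import Data.Fin using (Fin; toℕ; opposite; _≟_)
import Data.Fin.Properties as Fin
open import Data.Fin.Permutation as Permutation using ()
open import Data.Product using (_×_; _,_; ∃; proj₁; proj₂)
open import Function using (_∘_)
open import Data.List using (List; []; _∷_; length)
open import Data.Maybe using (nothing)
open import Relation.Binary.Bundles using (Setoid)
open import Relation.Nullary using (¬_; yes; no; Dec; contradiction)
open import Relation.Nullary.Decidable using (_×-dec_)
open import Relation.Binary.PropositionalEquality as ≡ using (_≡_)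
import Relation.Binary.Reasoning.Setoid as SetoidReasoning

module Sums {c ℓ : Level} (R : CommutativeRing c ℓ) where
  open CommutativeRing R
  open RingOps R using (sumF)
  open import Algebra.Properties.Semiring.Sum semiring
    using (sum; sum-cong-≋; sum-replicate-zero; sum-remove; ∑-distrib-+; ∑-comm; sum-permute;
           *-distribˡ-sum; *-distribʳ-sum)
  open import Algebra.Properties.Group +-group using (inverseˡ-unique)

  sumF≡sum : ∀ k (f : Fin k → Carrier) → sumF k f ≡ sum f
  sumF≡sum zero    f = ≡.refl
  sumF≡sum (suc k) f = ≡.cong (f Fin.zero +_) (sumF≡sum k (f ∘ Fin.suc))

  sumF≈sum : ∀ k (f : Fin k → Carrier) → sumF k f ≈ sum f
  sumF≈sum k f = reflexive (sumF≡sum k f)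

  sumF-cong : ∀ k {f g : Fin k → Carrier} → (∀ i → f i ≈ g i) → sumF k f ≈ sumF k g
  sumF-cong k {f} {g} f≈g = trans (sumF≈sum k f) (trans (sum-cong-≋ f≈g) (sym (sumF≈sum k g)))

  sumF-zero : ∀ k {f : Fin k → Carrier} → (∀ i → f i ≈ 0#) → sumF k f ≈ 0#
  sumF-zero k {f} f≈0 = trans (sumF≈sum k f) (trans (sum-cong-≋ f≈0) (sum-replicate-zero k))

  sumF-+ : ∀ k (f g : Fin k → Carrier) → sumF k (λ i → f i + g i) ≈ sumF k f + sumF k g
  sumF-+ k f g = trans (sumF≈sum k _)
    (trans (∑-distrib-+ f g) (sym (+-cong (sumF≈sum k f) (sumF≈sum k g))))

  sumF-neg : ∀ k (f : Fin k → Carrier) → sumF k (λ i → - f i) ≈ - sumF k f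
  sumF-neg k f = inverseˡ-unique _ _
    (trans (sym (sumF-+ k _ f)) (sumF-zero k (λ i → -‿inverseˡ (f i))))

  *-distribˡ-sumF : ∀ k x (f : Fin k → Carrier) → x * sumF k f ≈ sumF k (λ i → x * f i)
  *-distribˡ-sumF k x f = trans (*-congˡ (sumF≈sum k f))
    (trans (*-distribˡ-sum x f) (sym (sumF≈sum k _)))

  *-distribʳ-sumF : ∀ k x (f : Fin k → Carrier) → sumF k f * x ≈ sumF k (λ i → f i * x)
  *-distribʳ-sumF k x f = trans (*-congʳ (sumF≈sum k f))
    (trans (*-distribʳ-sum x f) (sym (sumF≈sum k _)))

  sumF-comm : ∀ k l (f : Fin k → Fin l → Carrier) →
    sumF k (λ i → sumF l (f i)) ≈ sumF l (λ j → sumF k (λ i → f i j))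
  sumF-comm k l f = begin
    sumF k (λ i → sumF l (f i))         ≈⟨ sumF-cong k (λ i → sumF≈sum l (f i)) ⟩
    sumF k (λ i → sum (f i))            ≈⟨ sumF≈sum k _ ⟩
    sum (λ i → sum (f i))               ≈⟨ ∑-comm f ⟩
    sum (λ j → sum (λ i → f i j))       ≈⟨ sumF≈sum l _ ⟨
    sumF l (λ j → sum (λ i → f i j))    ≈⟨ sumF-cong l (λ j → sumF≈sum k _) ⟨
    sumF l (λ j → sumF k (λ i → f i j)) ∎
    where open SetoidReasoning setoid

  sumF-reverse : ∀ k (f : Fin k → Carrier) → sumF k (f ∘ opposite) ≈ sumF k f
  sumF-reverse k f = trans (sumF≈sum k _)
    (trans (sym (sum-permute f Permutation.reverse)) (sym (sumF≈sum k f)))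

  sumF-single : ∀ k (f : Fin k → Carrier) i → (∀ j → ¬ i ≡ j → f j ≈ 0#) → sumF k f ≈ f i
  sumF-single (suc k) f i f≈0 = trans (sumF≈sum (suc k) f) (trans (sum-remove f)
    (trans (+-congˡ (trans (sum-cong-≋ (λ j → f≈0 _ (Fin.punchInᵢ≢i i j ∘ ≡.sym)))
                           (sum-replicate-zero k)))
           (+-identityʳ (f i))))

  sumF-select : ∀ k (e g : Fin k → Carrier) i → e i ≈ 1# → (∀ j → ¬ i ≡ j → e j ≈ 0#) →
    sumF k (λ j → e j * g j) ≈ g i
  sumF-select k e g i eᵢ≈1 e≈0 =
    trans (sumF-single k _ i (λ j i≢j → trans (*-congʳ (e≈0 j i≢j)) (zeroˡ (g j))))
          (trans (*-congʳ eᵢ≈1) (*-identityˡ (g i)))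

  sumF-selectʳ : ∀ k (e g : Fin k → Carrier) i → e i ≈ 1# → (∀ j → ¬ i ≡ j → e j ≈ 0#) →
    sumF k (λ j → g j * e j) ≈ g i
  sumF-selectʳ k e g i eᵢ≈1 e≈0 = trans (sumF-cong k (λ j → *-comm (g j) (e j))) (sumF-select k e g i eᵢ≈1 e≈0)

module Matrices {c ℓ : Level} (R : CommutativeRing c ℓ) where
  open CommutativeRing R
  open RingOps R using (sumF)
  open Sums R

  Matrix : ℕ → ℕ → Set c
  Matrix m n = Fin m → Fin n → Carrier

  infix 4 _≈ᴹ_
  _≈ᴹ_ : ∀ {m n} → Matrix m n → Matrix m n → Set ℓ
  A ≈ᴹ B = ∀ i j → A i j ≈ B i j

  ≈ᴹ-setoid : ℕ → ℕ → Setoid c ℓ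
  ≈ᴹ-setoid m n = record
    { Carrier       = Matrix m n
    ; _≈_           = _≈ᴹ_
    ; isEquivalence = record
      { refl  = λ i j → refl
      ; sym   = λ A≈B i j → sym (A≈B i j)
      ; trans = λ A≈B B≈C i j → trans (A≈B i j) (B≈C i j) } }

  module ≈ᴹ {m n : ℕ} = Setoid (≈ᴹ-setoid m n)
  module ≈ᴹ-Reasoning {m n : ℕ} = SetoidReasoning (≈ᴹ-setoid m n)

  infixl 7 _⊙_
  _⊙_ : ∀ {m n k} → Matrix m n → Matrix n k → Matrix m k
  _⊙_ {n = n} A B i j = sumF n (λ l → A i l * B l j)

  infixl 6 _+ᴹ_ _-ᴹ_
  _+ᴹ_ _-ᴹ_ : ∀ {m n} → Matrix m n → Matrix m n → Matrix m n
  (A +ᴹ B) i j = A i j + B i j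
  (A -ᴹ B) i j = A i j - B i j

  0ᴹ : ∀ {m n} → Matrix m n
  0ᴹ i j = 0#

  _ᵀ : ∀ {m n} → Matrix m n → Matrix n m
  (A ᵀ) i j = A j i

  antitranspose : ∀ {m n} → Matrix m n → Matrix n m
  antitranspose A i j = A (opposite j) (opposite i)

  ⊙-cong : ∀ {m n k} {A A' : Matrix m n} {B B' : Matrix n k} → A ≈ᴹ A' → B ≈ᴹ B' → A ⊙ B ≈ᴹ A' ⊙ B'
  ⊙-cong {n = n} A≈A' B≈B' i j = sumF-cong n (λ l → *-cong (A≈A' i l) (B≈B' l j))

  ⊙-congˡ : ∀ {m n k} (A : Matrix m n) {B B' : Matrix n k} → B ≈ᴹ B' → A ⊙ B ≈ᴹ A ⊙ B'
  ⊙-congˡ A = ⊙-cong (≈ᴹ.refl {x = A})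

  ⊙-congʳ : ∀ {m n k} {A A' : Matrix m n} (B : Matrix n k) → A ≈ᴹ A' → A ⊙ B ≈ᴹ A' ⊙ B
  ⊙-congʳ B A≈A' = ⊙-cong A≈A' (≈ᴹ.refl {x = B})

  ⊙-assoc : ∀ {m n k p} (A : Matrix m n) (B : Matrix n k) (C : Matrix k p) →
    (A ⊙ B) ⊙ C ≈ᴹ A ⊙ (B ⊙ C)
  ⊙-assoc {n = n} {k} A B C i j = begin
    sumF k (λ l → sumF n (λ t → A i t * B t l) * C l j)
      ≈⟨ sumF-cong k (λ l → *-distribʳ-sumF n (C l j) _) ⟩
    sumF k (λ l → sumF n (λ t → A i t * B t l * C l j))
      ≈⟨ sumF-comm k n _ ⟩
    sumF n (λ t → sumF k (λ l → A i t * B t l * C l j))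
      ≈⟨ sumF-cong n (λ t → sumF-cong k (λ l → *-assoc _ _ _)) ⟩
    sumF n (λ t → sumF k (λ l → A i t * (B t l * C l j)))
      ≈⟨ sumF-cong n (λ t → *-distribˡ-sumF k (A i t) _) ⟨
    sumF n (λ t → A i t * sumF k (λ l → B t l * C l j))   ∎
    where open SetoidReasoning setoid

  ⊙-distribˡ-+ᴹ : ∀ {m n k} (A : Matrix m n) (B C : Matrix n k) → A ⊙ (B +ᴹ C) ≈ᴹ A ⊙ B +ᴹ A ⊙ C
  ⊙-distribˡ-+ᴹ {n = n} A B C i j = trans (sumF-cong n (λ l → distribˡ (A i l) _ _)) (sumF-+ n _ _)

  ⊙-distribʳ-+ᴹ : ∀ {m n k} (A B : Matrix m n) (C : Matrix n k) → (A +ᴹ B) ⊙ C ≈ᴹ A ⊙ C +ᴹ B ⊙ C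
  ⊙-distribʳ-+ᴹ {n = n} A B C i j = trans (sumF-cong n (λ l → distribʳ (C l j) _ _)) (sumF-+ n _ _)

  ⊙-distribˡ-subᴹ : ∀ {m n k} (A : Matrix m n) (B C : Matrix n k) → A ⊙ (B -ᴹ C) ≈ᴹ A ⊙ B -ᴹ A ⊙ C
  ⊙-distribˡ-subᴹ {n = n} A B C i j = begin
    sumF n (λ l → A i l * (B l j - C l j))
      ≈⟨ sumF-cong n (λ l → trans (distribˡ (A i l) _ _) (+-congˡ (sym (-‿distribʳ-* _ _)))) ⟩
    sumF n (λ l → A i l * B l j + - (A i l * C l j))
      ≈⟨ sumF-+ n _ _ ⟩
    (A ⊙ B) i j + sumF n (λ l → - (A i l * C l j))
      ≈⟨ +-congˡ (sumF-neg n _) ⟩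
    (A ⊙ B) i j - (A ⊙ C) i j                         ∎
    where open SetoidReasoning setoid
          open import Algebra.Properties.Ring ring using (-‿distribʳ-*)

  ⊙-distribʳ-subᴹ : ∀ {m n k} (A B : Matrix m n) (C : Matrix n k) → (A -ᴹ B) ⊙ C ≈ᴹ A ⊙ C -ᴹ B ⊙ C
  ⊙-distribʳ-subᴹ {n = n} A B C i j = begin
    sumF n (λ l → (A i l - B i l) * C l j)
      ≈⟨ sumF-cong n (λ l → trans (distribʳ (C l j) _ _) (+-congˡ (sym (-‿distribˡ-* _ _)))) ⟩
    sumF n (λ l → A i l * C l j + - (B i l * C l j))
      ≈⟨ sumF-+ n _ _ ⟩
    (A ⊙ C) i j + sumF n (λ l → - (B i l * C l j))
      ≈⟨ +-congˡ (sumF-neg n _) ⟩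
    (A ⊙ C) i j - (B ⊙ C) i j                         ∎
    where open SetoidReasoning setoid
          open import Algebra.Properties.Ring ring using (-‿distribˡ-*)

  ⊙-zeroˡ : ∀ {m n k} {A : Matrix m n} (B : Matrix n k) → A ≈ᴹ 0ᴹ → A ⊙ B ≈ᴹ 0ᴹ
  ⊙-zeroˡ {n = n} B A≈0 i j = sumF-zero n (λ l → trans (*-congʳ (A≈0 i l)) (zeroˡ _))

  ⊙-zeroʳ : ∀ {m n k} (A : Matrix m n) {B : Matrix n k} → B ≈ᴹ 0ᴹ → A ⊙ B ≈ᴹ 0ᴹ
  ⊙-zeroʳ {n = n} A B≈0 i j = sumF-zero n (λ l → trans (*-congˡ (B≈0 l j)) (zeroʳ _))

  ᵀ-⊙ : ∀ {m n k} (A : Matrix m n) (B : Matrix n k) → (A ⊙ B) ᵀ ≈ᴹ B ᵀ ⊙ A ᵀ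
  ᵀ-⊙ {n = n} A B i j = sumF-cong n (λ l → *-comm _ _)

  antitranspose-cong : ∀ {m n} {A B : Matrix m n} → A ≈ᴹ B → antitranspose A ≈ᴹ antitranspose B
  antitranspose-cong A≈B i j = A≈B (opposite j) (opposite i)

  antitranspose-involutive : ∀ {m n} (A : Matrix m n) → antitranspose (antitranspose A) ≈ᴹ A
  antitranspose-involutive A i j =
    reflexive (≡.cong₂ A (Fin.opposite-involutive i) (Fin.opposite-involutive j))

  antitranspose-⊙ : ∀ {m n k} (A : Matrix m n) (B : Matrix n k) →
    antitranspose (A ⊙ B) ≈ᴹ antitranspose B ⊙ antitranspose A
  antitranspose-⊙ {n = n} A B i j = begin
    sumF n (λ l → A (opposite j) l * B l (opposite i))
      ≈⟨ sumF-reverse n _ ⟨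
    sumF n (λ l → A (opposite j) (opposite l) * B (opposite l) (opposite i))
      ≈⟨ sumF-cong n (λ l → *-comm _ _) ⟩
    sumF n (λ l → B (opposite l) (opposite i) * A (opposite j) (opposite l)) ∎
    where open SetoidReasoning setoid

  Lower Upper : ∀ {n} → Matrix n n → Set ℓ
  Lower A = ∀ i j → toℕ i < toℕ j → A i j ≈ 0#
  Upper A = ∀ i j → toℕ j < toℕ i → A i j ≈ 0#

  Lower-resp : ∀ {n} {A B : Matrix n n} → A ≈ᴹ B → Lower A → Lower B
  Lower-resp A≈B lowA i j i<j = trans (sym (A≈B i j)) (lowA i j i<j)

  Upper-resp : ∀ {n} {A B : Matrix n n} → A ≈ᴹ B → Upper A → Upper B
  Upper-resp A≈B upA i j j<i = trans (sym (A≈B i j)) (upA i j j<i)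

  Lower-⊙ : ∀ {n} {A B : Matrix n n} → Lower A → Lower B → Lower (A ⊙ B)
  Lower-⊙ {n} {A} {B} lowA lowB i j i<j = sumF-zero n term
    where
    term : ∀ l → A i l * B l j ≈ 0#
    term l with toℕ i ℕ.<? toℕ l
    ... | yes i<l = trans (*-congʳ (lowA i l i<l)) (zeroˡ _)
    ... | no  i≮l = trans (*-congˡ (lowB l j (ℕ.≤-<-trans (ℕ.≮⇒≥ i≮l) i<j))) (zeroʳ _)

  Upper-⊙ : ∀ {n} {A B : Matrix n n} → Upper A → Upper B → Upper (A ⊙ B)
  Upper-⊙ {n} {A} {B} upA upB i j j<i = sumF-zero n term
    where
    term : ∀ l → A i l * B l j ≈ 0#
    term l with toℕ l ℕ.<? toℕ i
    ... | yes l<i = trans (*-congʳ (upA i l l<i)) (zeroˡ _)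
    ... | no  l≮i = trans (*-congˡ (upB l j (ℕ.<-≤-trans j<i (ℕ.≮⇒≥ l≮i)))) (zeroʳ _)

  Upper-+ᴹ : ∀ {n} {A B : Matrix n n} → Upper A → Upper B → Upper (A +ᴹ B)
  Upper-+ᴹ upA upB i j j<i = trans (+-cong (upA i j j<i) (upB i j j<i)) (+-identityʳ 0#)

  Upper-ᵀ : ∀ {n} {A : Matrix n n} → Upper A → Lower (A ᵀ)
  Upper-ᵀ upA i j i<j = upA j i i<j

  opposite-< : ∀ {k} (i j : Fin k) → toℕ i < toℕ j → toℕ (opposite j) < toℕ (opposite i)
  opposite-< {k} i j i<j rewrite Fin.opposite-prop i | Fin.opposite-prop j =
    ℕ.∸-monoʳ-< {k} {suc (toℕ j)} {suc (toℕ i)} (s≤s i<j) (Fin.toℕ<n j)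

  Lower-antitranspose : ∀ {n} {A : Matrix n n} → Lower A → Lower (antitranspose A)
  Lower-antitranspose lowA i j i<j = lowA (opposite j) (opposite i) (opposite-< i j i<j)

  Upper-antitranspose : ∀ {n} {A : Matrix n n} → Upper A → Upper (antitranspose A)
  Upper-antitranspose upA i j j<i = upA (opposite j) (opposite i) (opposite-< j i j<i)

  lowerRight : ∀ {m n} → Matrix (suc m) (suc n) → Matrix m n
  lowerRight A i j = A (Fin.suc i) (Fin.suc j)

  lowerRight-⊙ : ∀ {m n k} (A : Matrix (suc m) (suc n)) (B : Matrix (suc n) (suc k)) →
    (∀ j → B Fin.zero (Fin.suc j) ≈ 0#) → lowerRight (A ⊙ B) ≈ᴹ lowerRight A ⊙ lowerRight B
  lowerRight-⊙ A B B₀≈0 i j =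
    trans (+-congʳ (trans (*-congˡ (B₀≈0 j)) (zeroʳ _))) (+-identityˡ _)

  firstRow-⊙ : ∀ {n k} (A : Matrix (suc n) (suc n)) (B : Matrix (suc n) k) →
    (∀ j → A Fin.zero (Fin.suc j) ≈ 0#) → ∀ j → (A ⊙ B) Fin.zero j ≈ A Fin.zero Fin.zero * B Fin.zero j
  firstRow-⊙ {n} A B A₀≈0 j =
    trans (+-congˡ (sumF-zero n (λ l → trans (*-congʳ (A₀≈0 l)) (zeroˡ _)))) (+-identityʳ _)

  SupportedOn : ∀ {n} → (Fin n → Fin n → Set) → Matrix n n → Set ℓ
  SupportedOn Rel A = ∀ i j → ¬ Rel i j → A i j ≈ 0#

module FieldFacts {c ℓ : Level} (K : ACF0 c ℓ) where
  open ACF0 K hiding (zero)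
  open import Algebra.Properties.Group +-group using (x∙y⁻¹≈ε⇒x≈y; x≈y⇒x∙y⁻¹≈ε; ∙-cancelˡ)

  unit-cancelʳ : ∀ {x u v} → u * v ≈ 1# → x * u ≈ 0# → x ≈ 0#
  unit-cancelʳ {x} {u} {v} uv≈1 xu≈0 = begin
    x             ≈⟨ *-identityʳ x ⟨
    x * 1#        ≈⟨ *-congˡ uv≈1 ⟨
    x * (u * v)   ≈⟨ *-assoc x u v ⟨
    x * u * v     ≈⟨ *-congʳ xu≈0 ⟩
    0# * v        ≈⟨ zeroˡ v ⟩
    0#            ∎
    where open SetoidReasoning setoid

  nonzero-cancelˡ : ∀ {d x} → ¬ d ≈ 0# → d * x ≈ 0# → x ≈ 0#
  nonzero-cancelˡ {d} {x} d≉0 dx≈0 =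
    unit-cancelʳ (proj₂ (inverses d d≉0)) (trans (*-comm x d) dx≈0)

  natEmb-separated : ∀ i j → ¬ i ≡ j → ¬ natEmb i - natEmb j ≈ 0#
  natEmb-separated zero    zero    i≢j _    = i≢j ≡.refl
  natEmb-separated zero    (suc j) _   diff = char0 j (sym (x∙y⁻¹≈ε⇒x≈y _ _ diff))
  natEmb-separated (suc i) zero    _   diff = char0 i (x∙y⁻¹≈ε⇒x≈y _ _ diff)
  natEmb-separated (suc i) (suc j) i≢j diff = natEmb-separated i j (i≢j ∘ ≡.cong suc)
    (x≈y⇒x∙y⁻¹≈ε (∙-cancelˡ 1# _ _ (x∙y⁻¹≈ε⇒x≈y _ _ diff)))

module SquareMatrices {c ℓ : Level} (K : ACF0 c ℓ) where
  open ACF0 K hiding (zero)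
  open Sums cring
  open Matrices cring
  open FieldFacts K using (unit-cancelʳ)

  I : ∀ n → Matrix n n
  I = idMat K

  I-diag : ∀ {n} (i j : Fin n) → i ≡ j → I n i j ≈ 1#
  I-diag i j i≡j with i ≟ j
  ... | yes _   = refl
  ... | no  i≢j = contradiction i≡j i≢j

  I-offdiag : ∀ {n} (i j : Fin n) → ¬ i ≡ j → I n i j ≈ 0#
  I-offdiag i j i≢j with i ≟ j
  ... | yes i≡j = contradiction i≡j i≢j
  ... | no  _   = refl

  I-resp : ∀ {m n} (i j : Fin m) (i' j' : Fin n) → (i ≡ j → i' ≡ j') → (i' ≡ j' → i ≡ j) →
    I m i j ≈ I n i' j'
  I-resp i j i' j' to from with i ≟ j
  ... | yes i≡j = sym (I-diag i' j' (to i≡j))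
  ... | no  i≢j = sym (I-offdiag i' j' (i≢j ∘ from))

  ⊙-identityˡ : ∀ {m n} (A : Matrix m n) → I m ⊙ A ≈ᴹ A
  ⊙-identityˡ {m} A i j = sumF-select m (I m i) (λ l → A l j) i (I-diag i i ≡.refl) (I-offdiag i)

  ⊙-identityʳ : ∀ {m n} (A : Matrix m n) → A ⊙ I n ≈ᴹ A
  ⊙-identityʳ {n = n} A i j =
    sumF-selectʳ n (λ l → I n l j) (A i) j (I-diag j j ≡.refl) (λ l j≢l → I-offdiag l j (j≢l ∘ ≡.sym))

  I-lowerRight : ∀ n → lowerRight (I (suc n)) ≈ᴹ I n
  I-lowerRight n i j = I-resp _ _ i j Fin.suc-injective (≡.cong Fin.suc)

  I-antitranspose : ∀ n → antitranspose (I n) ≈ᴹ I n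
  I-antitranspose n i j = I-resp _ _ i j (≡.sym ∘ opposite-injective) (≡.cong opposite ∘ ≡.sym)

  Iᵀ : ∀ n → I n ᵀ ≈ᴹ I n
  Iᵀ n i j = I-resp _ _ i j ≡.sym ≡.sym

  Upper-I : ∀ n → Upper (I n)
  Upper-I n i j j<i = I-offdiag i j (λ i≡j → ℕ.<-irrefl (≡.cong toℕ (≡.sym i≡j)) j<i)

  ⊙-inverse-unique : ∀ {n} {D B C : Matrix n n} → D ⊙ B ≈ᴹ I n → B ⊙ C ≈ᴹ I n → D ≈ᴹ C
  ⊙-inverse-unique {n} {D} {B} {C} DB≈I BC≈I = begin
    D             ≈⟨ ⊙-identityʳ D ⟨
    D ⊙ I n       ≈⟨ ⊙-congˡ D BC≈I ⟨
    D ⊙ (B ⊙ C)   ≈⟨ ⊙-assoc D B C ⟨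
    (D ⊙ B) ⊙ C   ≈⟨ ⊙-congʳ C DB≈I ⟩
    I n ⊙ C       ≈⟨ ⊙-identityˡ C ⟩
    C             ∎
    where open ≈ᴹ-Reasoning

  ⊙-cancel-middle : ∀ {m n k p} (A : Matrix m n) (P : Matrix n k) (Q : Matrix k n) (B : Matrix n p) →
    P ⊙ Q ≈ᴹ I n → (A ⊙ P) ⊙ (Q ⊙ B) ≈ᴹ A ⊙ B
  ⊙-cancel-middle {n = n} A P Q B PQ≈I = begin
    (A ⊙ P) ⊙ (Q ⊙ B)   ≈⟨ ⊙-assoc A P (Q ⊙ B) ⟩
    A ⊙ (P ⊙ (Q ⊙ B))   ≈⟨ ⊙-congˡ A (⊙-assoc P Q B) ⟨
    A ⊙ ((P ⊙ Q) ⊙ B)   ≈⟨ ⊙-congˡ A (⊙-congʳ B PQ≈I) ⟩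
    A ⊙ (I n ⊙ B)       ≈⟨ ⊙-congˡ A (⊙-identityˡ B) ⟩
    A ⊙ B               ∎
    where open ≈ᴹ-Reasoning

  ⊙-cancelˡ : ∀ {n k p} (P : Matrix n k) (Q : Matrix k n) (B : Matrix n p) → P ⊙ Q ≈ᴹ I n → P ⊙ (Q ⊙ B) ≈ᴹ B
  ⊙-cancelˡ P Q B PQ≈I =
    ≈ᴹ.trans (≈ᴹ.sym (⊙-assoc P Q B)) (≈ᴹ.trans (⊙-congʳ B PQ≈I) (⊙-identityˡ B))

  ⊙-cancelʳ : ∀ {m n k} (A : Matrix m n) (P : Matrix n k) (Q : Matrix k n) → P ⊙ Q ≈ᴹ I n → (A ⊙ P) ⊙ Q ≈ᴹ A
  ⊙-cancelʳ A P Q PQ≈I =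
    ≈ᴹ.trans (⊙-assoc A P Q) (≈ᴹ.trans (⊙-congˡ A PQ≈I) (⊙-identityʳ A))

  Invertible-⊙ : ∀ {n} {A B : Matrix n n} → Invertible K A → Invertible K B → Invertible K (A ⊙ B)
  Invertible-⊙ {A = A} {B} (A⁻¹ , AA⁻¹≈I , A⁻¹A≈I) (B⁻¹ , BB⁻¹≈I , B⁻¹B≈I) =
    B⁻¹ ⊙ A⁻¹ ,
    ≈ᴹ.trans (⊙-cancel-middle A B B⁻¹ A⁻¹ BB⁻¹≈I) AA⁻¹≈I ,
    ≈ᴹ.trans (⊙-cancel-middle B⁻¹ A⁻¹ A B A⁻¹A≈I) B⁻¹B≈I

  antitranspose-inverse : ∀ {n} {A B : Matrix n n} → A ⊙ B ≈ᴹ I n →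
    antitranspose B ⊙ antitranspose A ≈ᴹ I n
  antitranspose-inverse {n} {A} {B} AB≈I = begin
    antitranspose B ⊙ antitranspose A ≈⟨ antitranspose-⊙ A B ⟨
    antitranspose (A ⊙ B)             ≈⟨ antitranspose-cong AB≈I ⟩
    antitranspose (I n)               ≈⟨ I-antitranspose n ⟩
    I n                               ∎
    where open ≈ᴹ-Reasoning

  ᵀ-inverse : ∀ {n} {A B : Matrix n n} → A ⊙ B ≈ᴹ I n → B ᵀ ⊙ A ᵀ ≈ᴹ I n
  ᵀ-inverse {n} {A} {B} AB≈I = begin
    B ᵀ ⊙ A ᵀ   ≈⟨ ᵀ-⊙ A B ⟨
    (A ⊙ B) ᵀ   ≈⟨ (λ i j → AB≈I j i) ⟩
    I n ᵀ       ≈⟨ Iᵀ n ⟩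
    I n         ∎
    where open ≈ᴹ-Reasoning

  record LowerPattern (n : ℕ) : Set₁ where
    field
      Rel       : Fin n → Fin n → Set
      Rel?      : ∀ i j → Dec (Rel i j)
      Rel-refl  : ∀ i → Rel i i
      Rel-trans : ∀ {i j k} → Rel i j → Rel j k → Rel i k
      Rel-below : ∀ {i j} → Rel i j → toℕ j ≤ toℕ i

  restrict : ∀ {n} → LowerPattern (suc n) → LowerPattern n
  restrict P = record
    { Rel       = λ i j → Rel (Fin.suc i) (Fin.suc j)
    ; Rel?      = λ i j → Rel? (Fin.suc i) (Fin.suc j)
    ; Rel-refl  = Rel-refl ∘ Fin.suc
    ; Rel-trans = Rel-trans
    ; Rel-below = ℕ.≤-pred ∘ Rel-below }
    where open LowerPattern P

  ≥-pattern : ∀ n → LowerPattern n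
  ≥-pattern n = record
    { Rel       = λ i j → toℕ j ≤ toℕ i
    ; Rel?      = λ i j → toℕ j ℕ.≤? toℕ i
    ; Rel-refl  = λ i → ℕ.≤-refl
    ; Rel-trans = λ j≤i k≤j → ℕ.≤-trans k≤j j≤i
    ; Rel-below = λ j≤i → j≤i }

  SupportedOn-inverse : ∀ n (P : LowerPattern n) {B C : Matrix n n} →
    SupportedOn (LowerPattern.Rel P) B → B ⊙ C ≈ᴹ I n → C ⊙ B ≈ᴹ I n →
    SupportedOn (LowerPattern.Rel P) C
  SupportedOn-inverse zero    P suppB BC≈I CB≈I ()
  SupportedOn-inverse (suc n) P {B} {C} suppB BC≈I CB≈I = suppC
    where
    open LowerPattern P
    open SetoidReasoning setoid

    B₀≈0 : ∀ k → B Fin.zero (Fin.suc k) ≈ 0#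
    B₀≈0 k = suppB Fin.zero (Fin.suc k) (λ r → ℕ.<-irrefl ≡.refl (ℕ.<-≤-trans (s≤s z≤n) (Rel-below r)))

    first-row : ∀ k → B Fin.zero Fin.zero * C Fin.zero k ≈ I (suc n) Fin.zero k
    first-row k = trans (sym (firstRow-⊙ B C B₀≈0 k)) (BC≈I Fin.zero k)

    b₀₀c₀₀≈1 : B Fin.zero Fin.zero * C Fin.zero Fin.zero ≈ 1#
    b₀₀c₀₀≈1 = trans (first-row Fin.zero) (I-diag {suc n} Fin.zero Fin.zero ≡.refl)

    C₀≈0 : ∀ k → C Fin.zero (Fin.suc k) ≈ 0#
    C₀≈0 k = unit-cancelʳ b₀₀c₀₀≈1
      (trans (*-comm _ _) (trans (first-row (Fin.suc k)) (I-offdiag Fin.zero (Fin.suc k) (λ ()))))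

    lowerRight-inverse : ∀ (X Y : Matrix (suc n) (suc n)) → (∀ k → Y Fin.zero (Fin.suc k) ≈ 0#) →
      X ⊙ Y ≈ᴹ I (suc n) → lowerRight X ⊙ lowerRight Y ≈ᴹ I n
    lowerRight-inverse X Y Y₀≈0 XY≈I i j = begin
      (lowerRight X ⊙ lowerRight Y) i j ≈⟨ lowerRight-⊙ X Y Y₀≈0 i j ⟨
      (X ⊙ Y) (Fin.suc i) (Fin.suc j)   ≈⟨ XY≈I (Fin.suc i) (Fin.suc j) ⟩
      I (suc n) (Fin.suc i) (Fin.suc j) ≈⟨ I-lowerRight n i j ⟩
      I n i j                           ∎

    suppC' : SupportedOn (LowerPattern.Rel (restrict P)) (lowerRight C)
    suppC' = SupportedOn-inverse n (restrict P) (λ i j → suppB (Fin.suc i) (Fin.suc j))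
      (lowerRight-inverse B C C₀≈0 BC≈I) (lowerRight-inverse C B B₀≈0 CB≈I)

    first-column : ∀ i → ¬ Rel (Fin.suc i) Fin.zero → C (Fin.suc i) Fin.zero * B Fin.zero Fin.zero ≈ 0#
    first-column i ¬r = begin
      C (Fin.suc i) Fin.zero * B Fin.zero Fin.zero            ≈⟨ +-identityʳ _ ⟨
      C (Fin.suc i) Fin.zero * B Fin.zero Fin.zero + 0#       ≈⟨ +-congˡ (sumF-zero n term) ⟨
      (C ⊙ B) (Fin.suc i) Fin.zero                            ≈⟨ CB≈I (Fin.suc i) Fin.zero ⟩
      I (suc n) (Fin.suc i) Fin.zero                          ≈⟨ I-offdiag (Fin.suc i) Fin.zero (λ ()) ⟩
      0#                                                      ∎
      where
      -- a nonzero term would give Rel (suc i) (suc t) and Rel (suc t) 0, hence Rel (suc i) 0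
      term : ∀ t → C (Fin.suc i) (Fin.suc t) * B (Fin.suc t) Fin.zero ≈ 0#
      term t with Rel? (Fin.suc i) (Fin.suc t)
      ... | yes r  = trans (*-congˡ (suppB _ _ (¬r ∘ Rel-trans r))) (zeroʳ _)
      ... | no  ¬r' = trans (*-congʳ (suppC' i t ¬r')) (zeroˡ _)

    suppC : SupportedOn Rel C
    suppC Fin.zero     Fin.zero     ¬r = contradiction (Rel-refl Fin.zero) ¬r
    suppC Fin.zero     (Fin.suc k)  _  = C₀≈0 k
    suppC (Fin.suc i)  Fin.zero     ¬r = unit-cancelʳ b₀₀c₀₀≈1 (first-column i ¬r)
    suppC (Fin.suc i)  (Fin.suc k)  ¬r = suppC' i k ¬r

  Lower-rightInverse : ∀ n (B : Matrix n n) → Lower B → (∀ i → ¬ B i i ≈ 0#) →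
    ∃ λ C → B ⊙ C ≈ᴹ I n
  Lower-rightInverse zero    B lowB diag = (λ ()) , (λ ())
  Lower-rightInverse (suc n) B lowB diag = C , BC≈I
    where
    open SetoidReasoning setoid
    a  = B Fin.zero Fin.zero
    a⁻¹ = proj₁ (inverses a (diag Fin.zero))
    aa⁻¹≈1 : a * a⁻¹ ≈ 1#
    aa⁻¹≈1 = proj₂ (inverses a (diag Fin.zero))

    B' = lowerRight B
    C'-spec = Lower-rightInverse n B' (λ i j i<j → lowB _ _ (s≤s i<j)) (diag ∘ Fin.suc)
    C' = proj₁ C'-spec
    B'C'≈I = proj₂ C'-spec

    v : Matrix n 1
    v i _ = B (Fin.suc i) Fin.zero

    w : Matrix n 1
    w = C' ⊙ v

    -- block form [[a⁻¹, 0], [-(C' v) a⁻¹, C']] of the inverse of [[a, 0], [v, B']]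
    C : Matrix (suc n) (suc n)
    C Fin.zero    Fin.zero    = a⁻¹
    C Fin.zero    (Fin.suc k) = 0#
    C (Fin.suc i) Fin.zero    = - (w i Fin.zero * a⁻¹)
    C (Fin.suc i) (Fin.suc k) = C' i k

    B₀≈0 : ∀ k → B Fin.zero (Fin.suc k) ≈ 0#
    B₀≈0 k = lowB _ _ (s≤s z≤n)

    B'w≈v : B' ⊙ w ≈ᴹ v
    B'w≈v = ≈ᴹ.trans (≈ᴹ.sym (⊙-assoc B' C' v))
              (≈ᴹ.trans (⊙-congʳ v B'C'≈I) (⊙-identityˡ v))

    BC≈I : B ⊙ C ≈ᴹ I (suc n)
    BC≈I Fin.zero Fin.zero = begin
      (B ⊙ C) Fin.zero Fin.zero   ≈⟨ firstRow-⊙ B C B₀≈0 Fin.zero ⟩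
      a * a⁻¹                     ≈⟨ aa⁻¹≈1 ⟩
      1#                          ≈⟨ I-diag {suc n} Fin.zero Fin.zero ≡.refl ⟨
      I (suc n) Fin.zero Fin.zero ∎
    BC≈I Fin.zero (Fin.suc k) = begin
      (B ⊙ C) Fin.zero (Fin.suc k)   ≈⟨ firstRow-⊙ B C B₀≈0 (Fin.suc k) ⟩
      a * 0#                         ≈⟨ zeroʳ a ⟩
      0#                             ≈⟨ I-offdiag Fin.zero (Fin.suc k) (λ ()) ⟨
      I (suc n) Fin.zero (Fin.suc k) ∎
    BC≈I (Fin.suc i) Fin.zero = begin
      v i Fin.zero * a⁻¹ + sumF n (λ l → B' i l * - (w l Fin.zero * a⁻¹))
        ≈⟨ +-congˡ (sumF-cong n (λ l → trans (sym (-‿distribʳ-* _ _)) (-‿cong (sym (*-assoc _ _ _))))) ⟩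
      v i Fin.zero * a⁻¹ + sumF n (λ l → - (B' i l * w l Fin.zero * a⁻¹))
        ≈⟨ +-congˡ (trans (sumF-neg n _) (-‿cong (sym (*-distribʳ-sumF n a⁻¹ _)))) ⟩
      v i Fin.zero * a⁻¹ - (B' ⊙ w) i Fin.zero * a⁻¹
        ≈⟨ +-congˡ (-‿cong (*-congʳ (B'w≈v i Fin.zero))) ⟩
      v i Fin.zero * a⁻¹ - v i Fin.zero * a⁻¹
        ≈⟨ -‿inverseʳ _ ⟩
      0#
        ≈⟨ I-offdiag (Fin.suc i) Fin.zero (λ ()) ⟨
      I (suc n) (Fin.suc i) Fin.zero ∎
      where open import Algebra.Properties.Ring ring using (-‿distribʳ-*)
    BC≈I (Fin.suc i) (Fin.suc k) = begin
      (B ⊙ C) (Fin.suc i) (Fin.suc k)   ≈⟨ lowerRight-⊙ B C (λ _ → refl) i k ⟩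
      (B' ⊙ C') i k                     ≈⟨ B'C'≈I i k ⟩
      I n i k                           ≈⟨ I-lowerRight n i k ⟨
      I (suc n) (Fin.suc i) (Fin.suc k) ∎

  Lower-invertible : ∀ {n} {B : Matrix n n} → Lower B → (∀ i → ¬ B i i ≈ 0#) → Invertible K B
  Lower-invertible {n} {B} lowB diag = C , BC≈I , CB≈I
    where
    C-spec = Lower-rightInverse n B lowB diag
    C = proj₁ C-spec
    BC≈I = proj₂ C-spec
    -- a right inverse of the antitranspose yields a left inverse of B
    D-spec = Lower-rightInverse n (antitranspose B) (Lower-antitranspose lowB) (diag ∘ opposite)
    DB≈I : antitranspose (proj₁ D-spec) ⊙ B ≈ᴹ I n
    DB≈I = ≈ᴹ.trans (⊙-congˡ (antitranspose (proj₁ D-spec)) (≈ᴹ.sym (antitranspose-involutive B)))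
                    (antitranspose-inverse (proj₂ D-spec))
    CB≈I : C ⊙ B ≈ᴹ I n
    CB≈I = ≈ᴹ.trans (⊙-congʳ B (≈ᴹ.sym (⊙-inverse-unique DB≈I BC≈I))) DB≈I

  Lower-inverse : ∀ {n} {B C : Matrix n n} → Lower B → B ⊙ C ≈ᴹ I n → C ⊙ B ≈ᴹ I n → Lower C
  Lower-inverse {n} lowB BC≈I CB≈I i j i<j =
    SupportedOn-inverse n (≥-pattern n) (λ i j → lowB i j ∘ ℕ.≰⇒>) BC≈I CB≈I i j (ℕ.<⇒≱ i<j)

  Upper-inverse : ∀ {n} {B C : Matrix n n} → Upper B → B ⊙ C ≈ᴹ I n → C ⊙ B ≈ᴹ I n → Upper C
  Upper-inverse upB BC≈I CB≈I i j j<i =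
    Lower-inverse (Upper-ᵀ upB) (ᵀ-inverse CB≈I) (ᵀ-inverse BC≈I) j i j<i

  unipotent-inverse : ∀ {n} (N : Matrix n n) → N ⊙ N ≈ᴹ 0ᴹ →
    (I n +ᴹ N) ⊙ (I n -ᴹ N) ≈ᴹ I n × (I n -ᴹ N) ⊙ (I n +ᴹ N) ≈ᴹ I n
  unipotent-inverse {n} N N²≈0 = +⊙- , -⊙+
    where
    open SetoidReasoning setoid
    open import Algebra.Properties.Group +-group using (ε⁻¹≈ε)

    -N+N≈0 : ∀ i j → - N i j + (N ⊙ I n) i j ≈ 0#
    -N+N≈0 i j = trans (+-congˡ (⊙-identityʳ N i j)) (-‿inverseˡ (N i j))

    +⊙- : (I n +ᴹ N) ⊙ (I n -ᴹ N) ≈ᴹ I n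
    +⊙- i j = begin
      ((I n +ᴹ N) ⊙ (I n -ᴹ N)) i j
        ≈⟨ ⊙-distribʳ-+ᴹ (I n) N (I n -ᴹ N) i j ⟩
      (I n ⊙ (I n -ᴹ N)) i j + (N ⊙ (I n -ᴹ N)) i j
        ≈⟨ +-cong (⊙-identityˡ (I n -ᴹ N) i j) (⊙-distribˡ-subᴹ N (I n) N i j) ⟩
      (I n i j - N i j) + ((N ⊙ I n) i j - (N ⊙ N) i j)
        ≈⟨ +-congˡ (+-congˡ (trans (-‿cong (N²≈0 i j)) ε⁻¹≈ε)) ⟩
      (I n i j - N i j) + ((N ⊙ I n) i j + 0#)
        ≈⟨ +-congˡ (+-identityʳ _) ⟩
      (I n i j - N i j) + (N ⊙ I n) i j
        ≈⟨ +-assoc _ _ _ ⟩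
      I n i j + (- N i j + (N ⊙ I n) i j)
        ≈⟨ +-congˡ (-N+N≈0 i j) ⟩
      I n i j + 0#
        ≈⟨ +-identityʳ _ ⟩
      I n i j                                             ∎

    -⊙+ : (I n -ᴹ N) ⊙ (I n +ᴹ N) ≈ᴹ I n
    -⊙+ i j = begin
      ((I n -ᴹ N) ⊙ (I n +ᴹ N)) i j
        ≈⟨ ⊙-distribʳ-subᴹ (I n) N (I n +ᴹ N) i j ⟩
      (I n ⊙ (I n +ᴹ N)) i j - (N ⊙ (I n +ᴹ N)) i j
        ≈⟨ +-cong (⊙-identityˡ (I n +ᴹ N) i j) (-‿cong (⊙-distribˡ-+ᴹ N (I n) N i j)) ⟩
      (I n i j + N i j) - ((N ⊙ I n) i j + (N ⊙ N) i j)
        ≈⟨ +-congˡ (-‿cong (trans (+-congˡ (N²≈0 i j)) (+-identityʳ _))) ⟩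
      (I n i j + N i j) - (N ⊙ I n) i j
        ≈⟨ +-assoc _ _ _ ⟩
      I n i j + (N i j - (N ⊙ I n) i j)
        ≈⟨ +-congˡ (trans (+-congʳ (sym (⊙-identityʳ N i j))) (-‿inverseʳ _)) ⟩
      I n i j + 0#
        ≈⟨ +-identityʳ _ ⟩
      I n i j                                             ∎

  InBminus-⊙ : ∀ {n} {A B : Matrix n n} → InBminus K A → InBminus K B → InBminus K (A ⊙ B)
  InBminus-⊙ (lowA , invA) (lowB , invB) = Lower-⊙ lowA lowB , Invertible-⊙ invA invB

  InBplus-⊙ : ∀ {n} {A B : Matrix n n} → InBplus K A → InBplus K B → InBplus K (A ⊙ B)
  InBplus-⊙ (upA , invA) (upB , invB) = Upper-⊙ upA upB , Invertible-⊙ invA invB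

  Invertible-antitranspose : ∀ {n} {A : Matrix n n} → Invertible K A → Invertible K (antitranspose A)
  Invertible-antitranspose (A⁻¹ , AA⁻¹≈I , A⁻¹A≈I) =
    antitranspose A⁻¹ , antitranspose-inverse A⁻¹A≈I , antitranspose-inverse AA⁻¹≈I

  InBminus-antitranspose : ∀ {n} {A : Matrix n n} → InBminus K A → InBminus K (antitranspose A)
  InBminus-antitranspose (lowA , invA) = Lower-antitranspose lowA , Invertible-antitranspose invA

  InBplus-antitranspose : ∀ {n} {A : Matrix n n} → InBplus K A → InBplus K (antitranspose A)
  InBplus-antitranspose (upA , invA) = Upper-antitranspose upA , Invertible-antitranspose invA

module PartialPermutationMatrices {c ℓ : Level} (K : ACF0 c ℓ) where
  open ACF0 K hiding (zero)
  open Sums cring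
  open Matrices cring
  open SquareMatrices K

  γ-hit : ∀ {k} (i j : Fin k) → opposite i ≡ j → γMat K k i j ≈ 1#
  γ-hit i j i*≡j with opposite i ≟ j
  ... | yes _    = refl
  ... | no  i*≢j = contradiction i*≡j i*≢j

  γ-miss : ∀ {k} (i j : Fin k) → ¬ opposite i ≡ j → γMat K k i j ≈ 0#
  γ-miss i j i*≢j with opposite i ≟ j
  ... | yes i*≡j = contradiction i*≡j i*≢j
  ... | no  _    = refl

  γ-⊙ : ∀ {k n} (A : Matrix k n) i j → (γMat K k ⊙ A) i j ≈ A (opposite i) j
  γ-⊙ {k} A i j = sumF-select k (γMat K k i) (λ l → A l j) (opposite i) (γ-hit i _ ≡.refl) (γ-miss i)

  ⊙-γ : ∀ {m k} (A : Matrix m k) i j → (A ⊙ γMat K k) i j ≈ A i (opposite j)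
  ⊙-γ {k = k} A i j = sumF-selectʳ k (λ l → γMat K k l j) (A i) (opposite j)
    (γ-hit _ j (Fin.opposite-involutive j))
    (λ l j*≢l → γ-miss l j (λ l*≡j → j*≢l (≡.trans (≡.cong opposite (≡.sym l*≡j)) (Fin.opposite-involutive l))))

  module _ {m n : ℕ} (ρ : PPerm m n) where
    private
      σ = permMat K ρ
      f = fun ρ

    permMat-hit : ∀ i j → f i ≡ j → σ i j ≈ 1#
    permMat-hit i j fi≡j with f i ≟ j
    ... | yes _    = refl
    ... | no  fi≢j = contradiction fi≡j fi≢j

    permMat-miss : ∀ i j → ¬ f i ≡ j → σ i j ≈ 0#
    permMat-miss i j fi≢j with f i ≟ j
    ... | yes fi≡j = contradiction fi≡j fi≢j
    ... | no  _    = refl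

    permMat-column-miss : ∀ i {j k} → f k ≡ j → ¬ i ≡ k → σ i j ≈ 0#
    permMat-column-miss i fk≡j i≢k = permMat-miss i _ (λ fi≡j → i≢k (inj ρ (≡.trans fi≡j (≡.sym fk≡j))))

    ⊙-permMatᵀ : ∀ {p} (A : Matrix p n) i k → (A ⊙ σ ᵀ) i k ≈ A i (f k)
    ⊙-permMatᵀ A i k = sumF-selectʳ n (σ k) (A i) (f k) (permMat-hit k _ ≡.refl) (permMat-miss k)

    permMat-⊙ : ∀ {p} (A : Matrix n p) k l → (σ ⊙ A) k l ≈ A (f k) l
    permMat-⊙ A k l = sumF-select n (σ k) (λ j → A j l) (f k) (permMat-hit k _ ≡.refl) (permMat-miss k)

    ⊙-permMat-hit : ∀ {p} (A : Matrix p m) i {j} k → f k ≡ j → (A ⊙ σ) i j ≈ A i k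
    ⊙-permMat-hit A i k fk≡j = sumF-selectʳ m (λ k' → σ k' _) (A i) k (permMat-hit k _ fk≡j)
      (λ k' k≢k' → permMat-column-miss k' fk≡j (k≢k' ∘ ≡.sym))

    ⊙-permMat-miss : ∀ {p} (A : Matrix p m) i j → (∀ k → ¬ f k ≡ j) → (A ⊙ σ) i j ≈ 0#
    ⊙-permMat-miss A i j j∉f = sumF-zero m (λ k → trans (*-congˡ (permMat-miss k j (j∉f k))) (zeroʳ _))

    permMatᵀ-⊙-hit : ∀ {p} (A : Matrix m p) {j} l k → f k ≡ j → (σ ᵀ ⊙ A) j l ≈ A k l
    permMatᵀ-⊙-hit A l k fk≡j = sumF-select m (λ k' → σ k' _) (λ k' → A k' l) k (permMat-hit k _ fk≡j)
      (λ k' k≢k' → permMat-column-miss k' fk≡j (k≢k' ∘ ≡.sym))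

    permMatᵀ-⊙-miss : ∀ {p} (A : Matrix m p) j l → (∀ k → ¬ f k ≡ j) → (σ ᵀ ⊙ A) j l ≈ 0#
    permMatᵀ-⊙-miss A j l j∉f = sumF-zero m (λ k → trans (*-congʳ (permMat-miss k j (j∉f k))) (zeroˡ _))

    permMat-⊙-permMatᵀ : σ ⊙ σ ᵀ ≈ᴹ I m
    permMat-⊙-permMatᵀ i k = trans (permMat-⊙ (σ ᵀ) i k) (diagonal (i ≟ k))
      where
      diagonal : Dec (i ≡ k) → σ k (f i) ≈ I m i k
      diagonal (yes i≡k) = trans (permMat-hit k (f i) (≡.cong f (≡.sym i≡k))) (sym (I-diag i k i≡k))
      diagonal (no  i≢k) = trans (permMat-column-miss k ≡.refl (i≢k ∘ ≡.sym)) (sym (I-offdiag i k i≢k))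

    image? : ∀ j → Dec (∃ λ k → f k ≡ j)
    image? j = Fin.any? (λ k → f k ≟ j)

    Upper-permMatᵀ-⊙ : {A : Matrix m n} → (∀ k l → toℕ l < toℕ (f k) → A k l ≈ 0#) → Upper (σ ᵀ ⊙ A)
    Upper-permMatᵀ-⊙ {A} A≈0 j l l<j with image? j
    ... | yes (k , fk≡j) = trans (permMatᵀ-⊙-hit A l k fk≡j)
                             (A≈0 k l (≡.subst (λ j → toℕ l < toℕ j) (≡.sym fk≡j) l<j))
    ... | no  j∉f        = permMatᵀ-⊙-miss A j l (λ k fk≡j → j∉f (k , fk≡j))

    ⊙-permMat-zero : {B : Matrix m m} → (∀ k k' → toℕ (f k') < toℕ (f k) → B k k' ≈ 0#) →
      ∀ k l → toℕ l < toℕ (f k) → (B ⊙ σ) k l ≈ 0#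
    ⊙-permMat-zero {B} B≈0 k l l<fk with image? l
    ... | yes (k' , fk'≡l) = trans (⊙-permMat-hit B k k' fk'≡l)
                               (B≈0 k k' (≡.subst (λ l → toℕ l < toℕ (f k)) (≡.sym fk'≡l) l<fk))
    ... | no  l∉f          = ⊙-permMat-miss B k l (λ k' fk'≡l → l∉f (k' , fk'≡l))

  permMat-cong : ∀ {m n} (ρ ρ' : PPerm m n) → (∀ i → fun ρ i ≡ fun ρ' i) → permMat K ρ ≈ᴹ permMat K ρ'
  permMat-cong ρ ρ' ρ≗ρ' i j with fun ρ i ≟ j
  ... | yes ρi≡j = sym (permMat-hit ρ' i j (≡.trans (≡.sym (ρ≗ρ' i)) ρi≡j))
  ... | no  ρi≢j = sym (permMat-miss ρ' i j (λ ρ'i≡j → ρi≢j (≡.trans (ρ≗ρ' i) ρ'i≡j)))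

  permMat-antitranspose : ∀ {m n} (π : PPerm m n) → antitranspose (permMat K π) ≈ᴹ permMat K (γπγ π) ᵀ
  permMat-antitranspose π i j with fun π (opposite j) ≟ opposite i
  ... | yes π≡ = sym (permMat-hit (γπγ π) j i (≡.trans (≡.cong opposite π≡) (Fin.opposite-involutive i)))
  ... | no  π≢ = sym (permMat-miss (γπγ π) j i
                   (λ γπγ≡ → π≢ (≡.trans (≡.sym (Fin.opposite-involutive _)) (≡.cong opposite γπγ≡))))

module Involution {c ℓ : Level} (K : ACF0 c ℓ) where
  open ACF0 K hiding (zero)
  open Matrices cring
  open PartialPermutationMatrices K using (γ-⊙; ⊙-γ)

  infix 4 _≈ᴾ_
  _≈ᴾ_ : ∀ {m n} → Pt K m n → Pt K m n → Set ℓ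
  _≈ᴾ_ = _≈ₚ_ K

  ≈ₚ-sym : ∀ {m n} {p q : Pt K m n} → p ≈ᴾ q → q ≈ᴾ p
  ≈ₚ-sym (X≈ , Y≈) = ≈ᴹ.sym X≈ , ≈ᴹ.sym Y≈

  ≈ₚ-trans : ∀ {m n} {p q r : Pt K m n} → p ≈ᴾ q → q ≈ᴾ r → p ≈ᴾ r
  ≈ₚ-trans (X≈ , Y≈) (X≈' , Y≈') = ≈ᴹ.trans X≈ X≈' , ≈ᴹ.trans Y≈ Y≈'

  ι-antitranspose : ∀ {m n} (X : Matrix m n) (Y : Matrix n m) →
    ι K (X , Y) ≈ᴾ (antitranspose Y , antitranspose X)
  ι-antitranspose {m} {n} X Y =
    (λ i j → trans (⊙-γ (γMat K m ⊙ Y ᵀ) i j) (γ-⊙ (Y ᵀ) i (opposite j))) ,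
    (λ i j → trans (⊙-γ (γMat K n ⊙ X ᵀ) i j) (γ-⊙ (X ᵀ) i (opposite j)))

  ι-involutive : ∀ {m n} (p : Pt K m n) → ι K (ι K p) ≈ᴾ p
  ι-involutive (X , Y) =
    ≈ₚ-trans (ι-antitranspose X' Y')
      ( ≈ᴹ.trans (antitranspose-cong (proj₂ ιXY≈)) (antitranspose-involutive X)
      , ≈ᴹ.trans (antitranspose-cong (proj₁ ιXY≈)) (antitranspose-involutive Y))
    where
    ιXY≈ = ι-antitranspose X Y
    X' = proj₁ (ι K (X , Y))
    Y' = proj₂ (ι K (X , Y))

  InE-resp : ∀ {m n} {p q : Pt K m n} → p ≈ᴾ q → InE K p → InE K q
  InE-resp (X≈ , Y≈) (lowXY , upYX) = Lower-resp (⊙-cong X≈ Y≈) lowXY , Upper-resp (⊙-cong Y≈ X≈) upYX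

  InE-antitranspose : ∀ {m n} {X : Matrix m n} {Y : Matrix n m} →
    InE K (X , Y) → InE K (antitranspose Y , antitranspose X)
  InE-antitranspose {X = X} {Y} (lowXY , upYX) =
    Lower-resp (antitranspose-⊙ X Y) (Lower-antitranspose lowXY) ,
    Upper-resp (antitranspose-⊙ Y X) (Upper-antitranspose upYX)

  InE-ι : ∀ {m n} (p : Pt K m n) → InE K p → InE K (ι K p)
  InE-ι (X , Y) inE = InE-resp (≈ₚ-sym (ι-antitranspose X Y)) (InE-antitranspose inE)

module UnivariatePolynomials {c ℓ : Level} (K : ACF0 c ℓ) where
  open ACF0 K hiding (zero)
  open import Tactic.RingSolver.Core.AlmostCommutativeRing using (fromCommutativeRing)
  open import Tactic.RingSolver.NonReflective (fromCommutativeRing cring (λ _ → nothing))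
    using (solve; _⊜_) renaming (_⊕_ to _:+_; _⊗_ to _:*_; ⊝_ to :-_)
  open import Algebra.Properties.Ring ring using (-1*x≈-x)
  open FieldFacts K using (nonzero-cancelˡ; natEmb-separated)
  open SetoidReasoning setoid

  horner : List Carrier → Carrier → Carrier
  horner []       x = 0#
  horner (a ∷ as) x = a + x * horner as x

  infixl 6 _+ᶜ_
  _+ᶜ_ : List Carrier → List Carrier → List Carrier
  []       +ᶜ bs       = bs
  (a ∷ as) +ᶜ []       = a ∷ as
  (a ∷ as) +ᶜ (b ∷ bs) = a + b ∷ as +ᶜ bs

  horner-+ᶜ : ∀ as bs x → horner (as +ᶜ bs) x ≈ horner as x + horner bs x
  horner-+ᶜ []       bs       x = sym (+-identityˡ _)
  horner-+ᶜ (a ∷ as) []       x = sym (+-identityʳ _)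
  horner-+ᶜ (a ∷ as) (b ∷ bs) x = trans (+-congˡ (*-congˡ (horner-+ᶜ as bs x)))
    (solve 5 (λ a b x p q → ((a :+ b) :+ (x :* (p :+ q))) ⊜ ((a :+ (x :* p)) :+ (b :+ (x :* q)))) refl
       a b x (horner as x) (horner bs x))

  scale : Carrier → List Carrier → List Carrier
  scale a []       = []
  scale a (b ∷ bs) = a * b ∷ scale a bs

  horner-scale : ∀ a bs x → horner (scale a bs) x ≈ a * horner bs x
  horner-scale a []       x = sym (zeroʳ a)
  horner-scale a (b ∷ bs) x = trans (+-congˡ (*-congˡ (horner-scale a bs x)))
    (solve 4 (λ a b x p → ((a :* b) :+ (x :* (a :* p))) ⊜ (a :* (b :+ (x :* p)))) refl a b x (horner bs x))

  infixl 7 _*ᶜ_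
  _*ᶜ_ : List Carrier → List Carrier → List Carrier
  []       *ᶜ bs = []
  (a ∷ as) *ᶜ bs = scale a bs +ᶜ (0# ∷ as *ᶜ bs)

  horner-*ᶜ : ∀ as bs x → horner (as *ᶜ bs) x ≈ horner as x * horner bs x
  horner-*ᶜ []       bs x = sym (zeroˡ _)
  horner-*ᶜ (a ∷ as) bs x = begin
    horner (scale a bs +ᶜ (0# ∷ as *ᶜ bs)) x        ≈⟨ horner-+ᶜ (scale a bs) (0# ∷ as *ᶜ bs) x ⟩
    horner (scale a bs) x + (0# + x * horner (as *ᶜ bs) x)
      ≈⟨ +-cong (horner-scale a bs x) (trans (+-identityˡ _) (*-congˡ (horner-*ᶜ as bs x))) ⟩
    a * horner bs x + x * (horner as x * horner bs x)
      ≈⟨ +-congˡ (*-assoc x (horner as x) (horner bs x)) ⟨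
    a * horner bs x + x * horner as x * horner bs x   ≈⟨ distribʳ (horner bs x) a _ ⟨
    (a + x * horner as x) * horner bs x            ∎

  horner-neg : ∀ as x → horner (scale (- 1#) as) x ≈ - horner as x
  horner-neg as x = trans (horner-scale (- 1#) as x) (-1*x≈-x _)

  -- the coefficients of the quotient by (X - a) are the Horner values of the tails at a
  divide : List Carrier → Carrier → List Carrier
  divide []       a = []
  divide (b ∷ bs) a = horner (b ∷ bs) a ∷ divide bs a

  length-divide : ∀ bs a → length (divide bs a) ≡ length bs
  length-divide []       a = ≡.refl
  length-divide (b ∷ bs) a = ≡.cong suc (length-divide bs a)

  horner-divide : ∀ b bs a x → horner (b ∷ bs) x ≈ (x - a) * horner (divide bs a) x + horner (b ∷ bs) a
  horner-divide b []        a x = trans b+x*0≈b (sym (trans (+-cong (zeroʳ _) b+x*0≈b) (+-identityˡ b)))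
    where
    b+x*0≈b : ∀ {x} → b + x * 0# ≈ b
    b+x*0≈b {x} = trans (+-congˡ (zeroʳ x)) (+-identityʳ b)
  horner-divide b (b' ∷ bs) a x = begin
    b + x * horner (b' ∷ bs) x
      ≈⟨ +-congˡ (*-congˡ (horner-divide b' bs a x)) ⟩
    b + x * (y * q + p)
      ≈⟨ +-congˡ (*-congʳ x≈y+a) ⟩
    b + (y + a) * (y * q + p)
      ≈⟨ solve 5 (λ b a y p q → (b :+ ((y :+ a) :* ((y :* q) :+ p)))
                             ⊜ ((y :* (p :+ ((y :+ a) :* q))) :+ (b :+ (a :* p)))) refl b a y p q ⟩
    y * (p + (y + a) * q) + (b + a * p)
      ≈⟨ +-congʳ (*-congˡ (+-congˡ (*-congʳ x≈y+a))) ⟨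
    y * (p + x * q) + (b + a * p) ∎
    where
    -- the solver cannot cancel a against - a, so we expand around y = x - a
    y = x - a
    p = horner (b' ∷ bs) a
    q = horner (divide bs a) x
    x≈y+a : x ≈ y + a
    x≈y+a = sym (trans (+-assoc x (- a) a) (trans (+-congˡ (-‿inverseˡ a)) (+-identityʳ x)))

  Separated : (ℕ → Carrier) → Set ℓ
  Separated s = ∀ i j → ¬ i ≡ j → ¬ s i - s j ≈ 0#

  horner-zero-separated : ∀ n bs → length bs ≡ n → (s : ℕ → Carrier) → Separated s →
    (∀ j → horner bs (s j) ≈ 0#) → ∀ x → horner bs x ≈ 0#
  horner-zero-separated _       []       _   s sep roots x = refl
  horner-zero-separated zero    (b ∷ bs) ()
  horner-zero-separated (suc n) (b ∷ bs) len s sep roots x = begin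
    horner (b ∷ bs) x                                 ≈⟨ horner-divide b bs (s 0) x ⟩
    (x - s 0) * horner q x + horner (b ∷ bs) (s 0)    ≈⟨ +-cong (*-congˡ (q≈0 x)) (roots 0) ⟩
    (x - s 0) * 0# + 0#                               ≈⟨ trans (+-identityʳ _) (zeroʳ _) ⟩
    0#                                                ∎
    where
    q = divide bs (s 0)

    q-roots : ∀ j → horner q (s (suc j)) ≈ 0#
    q-roots j = nonzero-cancelˡ (sep (suc j) 0 (λ ())) (begin
      (s (suc j) - s 0) * horner q (s (suc j))
        ≈⟨ +-identityʳ _ ⟨
      (s (suc j) - s 0) * horner q (s (suc j)) + 0#
        ≈⟨ +-congˡ (roots 0) ⟨
      (s (suc j) - s 0) * horner q (s (suc j)) + horner (b ∷ bs) (s 0)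
        ≈⟨ horner-divide b bs (s 0) (s (suc j)) ⟨
      horner (b ∷ bs) (s (suc j))
        ≈⟨ roots (suc j) ⟩
      0#                                                                ∎)

    q≈0 : ∀ x → horner q x ≈ 0#
    q≈0 = horner-zero-separated n q (≡.trans (length-divide bs (s 0)) (ℕ.suc-injective len))
      (s ∘ suc) (λ i j i≢j → sep (suc i) (suc j) (i≢j ∘ ℕ.suc-injective)) q-roots

  horner-zero-off-origin : ∀ bs → (∀ x → ¬ x ≈ 0# → horner bs x ≈ 0#) → ∀ x → horner bs x ≈ 0#
  horner-zero-off-origin bs roots = horner-zero-separated _ bs ≡.refl (natEmb ∘ suc)
    (λ i j i≢j → natEmb-separated (suc i) (suc j) (i≢j ∘ ℕ.suc-injective)) (λ j → roots _ (char0 j))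

module PolynomialFunctions {c ℓ : Level} (K : ACF0 c ℓ) where
  open ACF0 K hiding (zero)
  open UnivariatePolynomials K

  Point : ℕ → Set c
  Point k = Fin k → Carrier

  infixr 5 _◂_
  _◂_ : ∀ {k} → Carrier → Point k → Point (suc k)
  (x ◂ r) Fin.zero    = x
  (x ◂ r) (Fin.suc i) = r i

  data IsPolynomial (k : ℕ) : (Point k → Carrier) → Set c where
    var   : ∀ i → IsPolynomial k (λ a → a i)
    const : ∀ x → IsPolynomial k (λ _ → x)
    add   : ∀ {F G} → IsPolynomial k F → IsPolynomial k G → IsPolynomial k (λ a → F a + G a)
    mul   : ∀ {F G} → IsPolynomial k F → IsPolynomial k G → IsPolynomial k (λ a → F a * G a)
    neg   : ∀ {F} → IsPolynomial k F → IsPolynomial k (λ a → - F a)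

  IsPolynomial-sumF : ∀ {k} n {G : Fin n → Point k → Carrier} → (∀ t → IsPolynomial k (G t)) →
    IsPolynomial k (λ a → sumF n (λ t → G t a))
  IsPolynomial-sumF zero    G-poly = const 0#
  IsPolynomial-sumF (suc n) G-poly = add (G-poly Fin.zero) (IsPolynomial-sumF n (G-poly ∘ Fin.suc))

  IsPolynomial-cong : ∀ {k F} → IsPolynomial k F → ∀ {a b : Point k} → (∀ i → a i ≈ b i) → F a ≈ F b
  IsPolynomial-cong (var i)   a≈b = a≈b i
  IsPolynomial-cong (const x) a≈b = refl
  IsPolynomial-cong (add P Q) a≈b = +-cong (IsPolynomial-cong P a≈b) (IsPolynomial-cong Q a≈b)
  IsPolynomial-cong (mul P Q) a≈b = *-cong (IsPolynomial-cong P a≈b) (IsPolynomial-cong Q a≈b)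
  IsPolynomial-cong (neg P)   a≈b = -‿cong (IsPolynomial-cong P a≈b)

  IsPolynomial-fixHead : ∀ {k F} → IsPolynomial (suc k) F → ∀ x → IsPolynomial k (λ r → F (x ◂ r))
  IsPolynomial-fixHead (var Fin.zero)    x = const x
  IsPolynomial-fixHead (var (Fin.suc i)) x = var i
  IsPolynomial-fixHead (const y)         x = const y
  IsPolynomial-fixHead (add P Q)         x = add (IsPolynomial-fixHead P x) (IsPolynomial-fixHead Q x)
  IsPolynomial-fixHead (mul P Q)         x = mul (IsPolynomial-fixHead P x) (IsPolynomial-fixHead Q x)
  IsPolynomial-fixHead (neg P)           x = neg (IsPolynomial-fixHead P x)

  IsPolynomial-inHead : ∀ {k F} → IsPolynomial (suc k) F → ∀ r →
    ∃ λ bs → ∀ x → F (x ◂ r) ≈ horner bs x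
  IsPolynomial-inHead (var Fin.zero)    r = (0# ∷ 1# ∷ []) , λ x →
    sym (trans (+-identityˡ _) (trans (*-congˡ (trans (+-congˡ (zeroʳ x)) (+-identityʳ 1#))) (*-identityʳ x)))
  IsPolynomial-inHead (var (Fin.suc i)) r = (r i ∷ []) , λ x → sym (trans (+-congˡ (zeroʳ x)) (+-identityʳ _))
  IsPolynomial-inHead (const y)         r = (y ∷ []) , λ x → sym (trans (+-congˡ (zeroʳ x)) (+-identityʳ _))
  IsPolynomial-inHead (add P Q)         r with IsPolynomial-inHead P r | IsPolynomial-inHead Q r
  ... | ps , P≈ | qs , Q≈ = ps +ᶜ qs , λ x → trans (+-cong (P≈ x) (Q≈ x)) (sym (horner-+ᶜ ps qs x))
  IsPolynomial-inHead (mul P Q)         r with IsPolynomial-inHead P r | IsPolynomial-inHead Q r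
  ... | ps , P≈ | qs , Q≈ = ps *ᶜ qs , λ x → trans (*-cong (P≈ x) (Q≈ x)) (sym (horner-*ᶜ ps qs x))
  IsPolynomial-inHead (neg P)           r with IsPolynomial-inHead P r
  ... | ps , P≈ = scale (- 1#) ps , λ x → trans (-‿cong (P≈ x)) (sym (horner-neg ps x))

  Torus : ∀ {k} → Point k → Set ℓ
  Torus a = ∀ i → ¬ a i ≈ 0#

  torus-dense : ∀ k {F} → IsPolynomial k F → (∀ a → Torus a → F a ≈ 0#) → ∀ a → F a ≈ 0#
  torus-dense zero    P F≈0 a = trans (IsPolynomial-cong P (λ ())) (F≈0 (λ ()) (λ ()))
  torus-dense (suc k) {F} P F≈0 a =
    trans (IsPolynomial-cong P head◂tail)
          (torus-dense k (IsPolynomial-fixHead P x) (λ r r∈T → zero-in-head r r∈T x) r)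
    where
    x = a Fin.zero
    r = a ∘ Fin.suc
    head◂tail : ∀ i → a i ≈ (x ◂ r) i
    head◂tail Fin.zero    = refl
    head◂tail (Fin.suc i) = refl
    zero-in-head : ∀ r → Torus r → ∀ y → F (y ◂ r) ≈ 0#
    zero-in-head r r∈T y with IsPolynomial-inHead P r
    ... | bs , F≈bs = trans (F≈bs y) (horner-zero-off-origin bs
      (λ z z≉0 → trans (sym (F≈bs z)) (F≈0 (z ◂ r) λ { Fin.zero → z≉0 ; (Fin.suc i) → r∈T i })) y)

module ZariskiClosure {c ℓ : Level} (K : ACF0 c ℓ) where
  open ACF0 K hiding (zero)
  open Matrices cring
  open Involution K
  open PolynomialFunctions K

  eval-cong : ∀ {m n} (g : Poly K m n) {p q : Pt K m n} → p ≈ᴾ q → eval K g p ≈ eval K g q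
  eval-cong (varX i j) (X≈ , Y≈) = X≈ i j
  eval-cong (varY i j) (X≈ , Y≈) = Y≈ i j
  eval-cong (con a)    p≈q       = refl
  eval-cong (g ⊕ h)    p≈q       = +-cong (eval-cong g p≈q) (eval-cong h p≈q)
  eval-cong (g ⊗ h)    p≈q       = *-cong (eval-cong g p≈q) (eval-cong h p≈q)
  eval-cong (⊝ g)      p≈q       = -‿cong (eval-cong g p≈q)

  pullback-ι : ∀ {m n} → Poly K m n → Poly K m n
  pullback-ι (varX i j) = varY (opposite j) (opposite i)
  pullback-ι (varY i j) = varX (opposite j) (opposite i)
  pullback-ι (con a)    = con a
  pullback-ι (g ⊕ h)    = pullback-ι g ⊕ pullback-ι h
  pullback-ι (g ⊗ h)    = pullback-ι g ⊗ pullback-ι h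
  pullback-ι (⊝ g)      = ⊝ pullback-ι g

  eval-pullback-ι : ∀ {m n} (g : Poly K m n) (p : Pt K m n) → eval K (pullback-ι g) p ≈ eval K g (ι K p)
  eval-pullback-ι g (X , Y) = trans (antitranspose-substitution g) (eval-cong g (≈ₚ-sym (ι-antitranspose X Y)))
    where
    antitranspose-substitution : ∀ g →
      eval K (pullback-ι g) (X , Y) ≈ eval K g (antitranspose Y , antitranspose X)
    antitranspose-substitution (varX i j) = refl
    antitranspose-substitution (varY i j) = refl
    antitranspose-substitution (con a)    = refl
    antitranspose-substitution (g ⊕ h)    = +-cong (antitranspose-substitution g) (antitranspose-substitution h)
    antitranspose-substitution (g ⊗ h)    = *-cong (antitranspose-substitution g) (antitranspose-substitution h)
    antitranspose-substitution (⊝ g)      = -‿cong (antitranspose-substitution g)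

  module _ {m n s t} {S : Pt K m n → Set s} {T : Pt K m n → Set t} where

    Closure-mono : (∀ q → S q → T q) → ∀ p → Closure K S p → Closure K T p
    Closure-mono S⊆T p p∈S̄ g g|T≈0 = p∈S̄ g (λ q q∈S → g|T≈0 q (S⊆T q q∈S))

    Closure-ι : (∀ q → S q → Closure K T (ι K q)) → ∀ p → Closure K S p → Closure K T (ι K p)
    Closure-ι ιS⊆T̄ p p∈S̄ g g|T≈0 = trans (sym (eval-pullback-ι g p))
      (p∈S̄ (pullback-ι g) (λ q q∈S → trans (eval-pullback-ι g q) (ιS⊆T̄ q q∈S g g|T≈0)))

  Closure-resp : ∀ {m n s} {T : Pt K m n → Set s} {p q : Pt K m n} → p ≈ᴾ q → Closure K T p → Closure K T q
  Closure-resp {p = p} {q} p≈q p∈T̄ g g|T≈0 = trans (sym (eval-cong g p≈q)) (p∈T̄ g g|T≈0)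

  PolynomialFamily : ∀ k {m n} → (Point k → Matrix m n) → Set c
  PolynomialFamily k A = ∀ i j → IsPolynomial k (λ a → A a i j)

  PolynomialFamily-const : ∀ {k m n} (A : Matrix m n) → PolynomialFamily k (λ _ → A)
  PolynomialFamily-const A i j = const (A i j)

  PolynomialFamily-⊙ : ∀ {k m n p} {A : Point k → Matrix m n} {B : Point k → Matrix n p} →
    PolynomialFamily k A → PolynomialFamily k B → PolynomialFamily k (λ a → A a ⊙ B a)
  PolynomialFamily-⊙ {n = n} A-poly B-poly i j = IsPolynomial-sumF n (λ l → mul (A-poly i l) (B-poly l j))

  PolynomialFamily-+ᴹ : ∀ {k m n} {A B : Point k → Matrix m n} →
    PolynomialFamily k A → PolynomialFamily k B → PolynomialFamily k (λ a → A a +ᴹ B a)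
  PolynomialFamily-+ᴹ A-poly B-poly i j = add (A-poly i j) (B-poly i j)

  IsPolynomial-eval : ∀ {k m n} {X : Point k → Matrix m n} {Y : Point k → Matrix n m} →
    PolynomialFamily k X → PolynomialFamily k Y → ∀ g → IsPolynomial k (λ a → eval K g (X a , Y a))
  IsPolynomial-eval {k} {X = X} {Y} X-poly Y-poly = poly
    where
    poly : ∀ g → IsPolynomial k (λ a → eval K g (X a , Y a))
    poly (varX i j) = X-poly i j
    poly (varY i j) = Y-poly i j
    poly (con a)    = const a
    poly (g ⊕ h)    = add (poly g) (poly h)
    poly (g ⊗ h)    = mul (poly g) (poly h)
    poly (⊝ g)      = neg (poly g)

  torus-family⊆Closure : ∀ {k m n t} {T : Pt K m n → Set t}
    {X : Point k → Matrix m n} {Y : Point k → Matrix n m} →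
    PolynomialFamily k X → PolynomialFamily k Y → (∀ a → Torus a → T (X a , Y a)) →
    ∀ a → Closure K T (X a , Y a)
  torus-family⊆Closure {k} X-poly Y-poly torus⊆T a g g|T≈0 =
    torus-dense k (IsPolynomial-eval X-poly Y-poly g) (λ b b∈T → g|T≈0 _ (torus⊆T b b∈T)) a

module CellClosure {c ℓ : Level} (K : ACF0 c ℓ) where
  open ACF0 K hiding (zero)
  open Sums cring
  open Matrices cring
  open SquareMatrices K
  open PartialPermutationMatrices K
  open PolynomialFunctions K
  open ZariskiClosure K
  open import Algebra.Properties.Group +-group using (ε⁻¹≈ε)

  InCell-⊙ : ∀ {m n} {π : PPerm m n} {b : Matrix m m} {X : Matrix m n} {u : Matrix n n} →
    InBminus K b → InCell K π X → InBplus K u → InCell K π ((b ⊙ X) ⊙ u)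
  InCell-⊙ {π = π} {b} {X} {u} b∈B₋ (b' , u' , b'∈B₋ , u'∈B₊ , X≈) u∈B₊ =
    b ⊙ b' , u' ⊙ u , InBminus-⊙ b∈B₋ b'∈B₋ , InBplus-⊙ u'∈B₊ u∈B₊ , (begin
      (b ⊙ X) ⊙ u                     ≈⟨ ⊙-congʳ u (⊙-congˡ b X≈) ⟩
      (b ⊙ ((b' ⊙ σ) ⊙ u')) ⊙ u       ≈⟨ ⊙-congʳ u (⊙-assoc b (b' ⊙ σ) u') ⟨
      ((b ⊙ (b' ⊙ σ)) ⊙ u') ⊙ u       ≈⟨ ⊙-congʳ u (⊙-congʳ u' (⊙-assoc b b' σ)) ⟨
      (((b ⊙ b') ⊙ σ) ⊙ u') ⊙ u       ≈⟨ ⊙-assoc ((b ⊙ b') ⊙ σ) u' u ⟩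
      ((b ⊙ b') ⊙ σ) ⊙ (u' ⊙ u)       ∎)
    where
    open ≈ᴹ-Reasoning
    σ = permMat K π

  module TorusFamily {m n} (ρ : PPerm m n) (W : Matrix m n)
    (lowWσᵀ : Lower (W ⊙ permMat K ρ ᵀ)) (upσᵀW : Upper (permMat K ρ ᵀ ⊙ W)) where

    private
      σ = permMat K ρ
      f = fun ρ

    W-zero : ∀ i l → toℕ l < toℕ (f i) → W i l ≈ 0#
    W-zero i l l<fi = trans (sym (permMatᵀ-⊙-hit ρ W l i ≡.refl)) (upσᵀW (f i) l l<fi)

    L : Matrix m m
    L = W ⊙ σ ᵀ

    support : LowerPattern m
    support = record
      { Rel       = λ i k → toℕ k ≤ toℕ i × toℕ (f i) ≤ toℕ (f k)
      ; Rel?      = λ i k → (toℕ k ℕ.≤? toℕ i) ×-dec (toℕ (f i) ℕ.≤? toℕ (f k))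
      ; Rel-refl  = λ i → ℕ.≤-refl , ℕ.≤-refl
      ; Rel-trans = λ (k≤i , fi≤fk) (l≤k , fk≤fl) → ℕ.≤-trans l≤k k≤i , ℕ.≤-trans fi≤fk fk≤fl
      ; Rel-below = proj₁ }

    open LowerPattern support using (Rel; Rel-refl; Rel-below)

    L-supported : SupportedOn Rel L
    L-supported i k ¬r with toℕ k ℕ.≤? toℕ i | toℕ (f i) ℕ.≤? toℕ (f k)
    ... | no  k≰i | _        = lowWσᵀ i k (ℕ.≰⇒> k≰i)
    ... | yes k≤i | yes fi≤fk = contradiction (k≤i , fi≤fk) ¬r
    ... | yes _   | no  fi≰fk = trans (⊙-permMatᵀ ρ W i k) (W-zero i (f k) (ℕ.≰⇒> fi≰fk))

    B : Point m → Matrix m m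
    B a i k with i ≟ k
    ... | yes _ = a i
    ... | no  _ = L i k

    B-diag : ∀ a i → B a i i ≈ a i
    B-diag a i with i ≟ i
    ... | yes _   = refl
    ... | no  i≢i = contradiction ≡.refl i≢i

    B-supported : ∀ a → SupportedOn Rel (B a)
    B-supported a i k ¬r with i ≟ k
    ... | yes ≡.refl = contradiction (Rel-refl i) ¬r
    ... | no  _      = L-supported i k ¬r

    B-lower : ∀ a → Lower (B a)
    B-lower a i k i<k = B-supported a i k (λ r → ℕ.<⇒≱ i<k (Rel-below r))

    B-polynomial : PolynomialFamily m B
    B-polynomial i k with i ≟ k
    ... | yes _ = var i
    ... | no  _ = const (L i k)

    diagonal : Point m
    diagonal i = L i i

    B-diagonal : B diagonal ≈ᴹ L
    B-diagonal i k with i ≟ k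
    ... | yes ≡.refl = refl
    ... | no  _      = refl

    R : Matrix m n
    R = W -ᴹ L ⊙ σ

    Lσ-zero : ∀ i l → toℕ l < toℕ (f i) → (L ⊙ σ) i l ≈ 0#
    Lσ-zero = ⊙-permMat-zero ρ (λ k k' fk'<fk → trans (⊙-permMatᵀ ρ W k k') (W-zero k (f k') fk'<fk))

    R-zero : ∀ i l → toℕ l < toℕ (f i) → R i l ≈ 0#
    R-zero i l l<fi = trans (+-cong (W-zero i l l<fi) (-‿cong (Lσ-zero i l l<fi)))
      (trans (+-congˡ ε⁻¹≈ε) (+-identityʳ 0#))

    R⊙σᵀ≈0 : R ⊙ σ ᵀ ≈ᴹ 0ᴹ
    R⊙σᵀ≈0 i k = begin
      (R ⊙ σ ᵀ) i k
        ≈⟨ ⊙-permMatᵀ ρ R i k ⟩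
      W i (f k) - (L ⊙ σ) i (f k)
        ≈⟨ +-congˡ (-‿cong (trans (⊙-permMat-hit ρ L i k ≡.refl) (⊙-permMatᵀ ρ W i k))) ⟩
      W i (f k) - W i (f k)
        ≈⟨ -‿inverseʳ _ ⟩
      0#                              ∎
      where open SetoidReasoning setoid

    Wₐ : Point m → Matrix m n
    Wₐ a = B a ⊙ σ +ᴹ R

    Wₐ-polynomial : PolynomialFamily m Wₐ
    Wₐ-polynomial = PolynomialFamily-+ᴹ (PolynomialFamily-⊙ B-polynomial (PolynomialFamily-const σ))
                                        (PolynomialFamily-const R)

    Wₐ-diagonal : Wₐ diagonal ≈ᴹ W
    Wₐ-diagonal i j = begin
      (B diagonal ⊙ σ) i j + (W i j - (L ⊙ σ) i j)   ≈⟨ +-congʳ (⊙-congʳ σ B-diagonal i j) ⟩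
      (L ⊙ σ) i j + (W i j - (L ⊙ σ) i j)            ≈⟨ +-comm _ _ ⟩
      (W i j - (L ⊙ σ) i j) + (L ⊙ σ) i j            ≈⟨ +-assoc _ _ _ ⟩
      W i j + (- (L ⊙ σ) i j + (L ⊙ σ) i j)          ≈⟨ +-congˡ (-‿inverseˡ _) ⟩
      W i j + 0#                                     ≈⟨ +-identityʳ _ ⟩
      W i j                                          ∎
      where open SetoidReasoning setoid

    Wₐ⊙σᵀ : ∀ a → Wₐ a ⊙ σ ᵀ ≈ᴹ B a
    Wₐ⊙σᵀ a i j = begin
      (Wₐ a ⊙ σ ᵀ) i j
        ≈⟨ ⊙-distribʳ-+ᴹ (B a ⊙ σ) R (σ ᵀ) i j ⟩
      ((B a ⊙ σ) ⊙ σ ᵀ) i j + (R ⊙ σ ᵀ) i j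
        ≈⟨ +-cong (⊙-cancelʳ (B a) σ (σ ᵀ) (permMat-⊙-permMatᵀ ρ) i j) (R⊙σᵀ≈0 i j) ⟩
      B a i j + 0#
        ≈⟨ +-identityʳ _ ⟩
      B a i j                                 ∎
      where open SetoidReasoning setoid

    Upper-σᵀ⊙Wₐ : ∀ a → Upper (σ ᵀ ⊙ Wₐ a)
    Upper-σᵀ⊙Wₐ a = Upper-resp (≈ᴹ.sym (⊙-distribˡ-+ᴹ (σ ᵀ) (B a ⊙ σ) R))
      (Upper-+ᴹ (Upper-permMatᵀ-⊙ ρ (⊙-permMat-zero ρ Bσ-zero)) (Upper-permMatᵀ-⊙ ρ R-zero))
      where
      Bσ-zero : ∀ k k' → toℕ (f k') < toℕ (f k) → B a k k' ≈ 0#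
      Bσ-zero k k' fk'<fk = B-supported a k k' (λ r → ℕ.<⇒≱ fk'<fk (proj₂ r))

    module OnTorus (a : Point m) (a∈T : Torus a) where

      B-invertible : Invertible K (B a)
      B-invertible = Lower-invertible (B-lower a) (λ i Bᵢᵢ≈0 → a∈T i (trans (sym (B-diag a i)) Bᵢᵢ≈0))

      C : Matrix m m
      C = proj₁ B-invertible

      C-supported : SupportedOn Rel C
      C-supported = SupportedOn-inverse m support (B-supported a)
        (proj₁ (proj₂ B-invertible)) (proj₂ (proj₂ B-invertible))

      CR-zero : ∀ k l → toℕ l < toℕ (f k) → (C ⊙ R) k l ≈ 0#
      CR-zero k l l<fk = sumF-zero m term
        where
        term : ∀ i → C k i * R i l ≈ 0#
        term i with LowerPattern.Rel? support k i
        ... | yes (_ , fk≤fi) = trans (*-congˡ (R-zero i l (ℕ.<-≤-trans l<fk fk≤fi))) (zeroʳ _)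
        ... | no  ¬r          = trans (*-congʳ (C-supported k i ¬r)) (zeroˡ _)

      N : Matrix n n
      N = σ ᵀ ⊙ (C ⊙ R)

      N²≈0 : N ⊙ N ≈ᴹ 0ᴹ
      N²≈0 = begin
        N ⊙ (σ ᵀ ⊙ (C ⊙ R))           ≈⟨ ⊙-assoc N (σ ᵀ) (C ⊙ R) ⟨
        (N ⊙ σ ᵀ) ⊙ (C ⊙ R)           ≈⟨ ⊙-congʳ (C ⊙ R) (⊙-assoc (σ ᵀ) (C ⊙ R) (σ ᵀ)) ⟩
        (σ ᵀ ⊙ ((C ⊙ R) ⊙ σ ᵀ)) ⊙ (C ⊙ R) ≈⟨ ⊙-congʳ (C ⊙ R) (⊙-congˡ (σ ᵀ) (⊙-assoc C R (σ ᵀ))) ⟩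
        (σ ᵀ ⊙ (C ⊙ (R ⊙ σ ᵀ))) ⊙ (C ⊙ R) ≈⟨ ⊙-zeroˡ (C ⊙ R) (⊙-zeroʳ (σ ᵀ) (⊙-zeroʳ C R⊙σᵀ≈0)) ⟩
        0ᴹ                              ∎
        where open ≈ᴹ-Reasoning

      U : Matrix n n
      U = I n +ᴹ N

      U-inBplus : InBplus K U
      U-inBplus = Upper-+ᴹ (Upper-I n) (Upper-permMatᵀ-⊙ ρ CR-zero) ,
                  I n -ᴹ N , unipotent-inverse N N²≈0

      Wₐ≈BσU : Wₐ a ≈ᴹ (B a ⊙ σ) ⊙ U
      Wₐ≈BσU = ≈ᴹ.sym (begin
        (B a ⊙ σ) ⊙ (I n +ᴹ N)             ≈⟨ ⊙-distribˡ-+ᴹ (B a ⊙ σ) (I n) N ⟩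
        (B a ⊙ σ) ⊙ I n +ᴹ (B a ⊙ σ) ⊙ N   ≈⟨ (λ i j → +-cong (⊙-identityʳ (B a ⊙ σ) i j) (BσN≈R i j)) ⟩
        Wₐ a                               ∎)
        where
        open ≈ᴹ-Reasoning
        BσN≈R : (B a ⊙ σ) ⊙ N ≈ᴹ R
        BσN≈R = ≈ᴹ.trans (⊙-cancel-middle (B a) σ (σ ᵀ) (C ⊙ R) (permMat-⊙-permMatᵀ ρ))
                          (⊙-cancelˡ (B a) C R (proj₁ (proj₂ B-invertible)))

    Wₐ-cell : ∀ a → Torus a → InCell K ρ (Wₐ a)
    Wₐ-cell a a∈T = B a , U , (B-lower a , B-invertible) , U-inBplus , Wₐ≈BσU
      where open OnTorus a a∈T

  InECell : ∀ {m n} → PPerm m n → Pt K m n → Set (c ⊔ ℓ)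
  InECell π p = InE K p × InCell K π (proj₁ p)

  InEπ-of-Y-cell : ∀ {m n} (ρ : PPerm m n) {X : Matrix m n} {Y : Matrix n m} → InE K (X , Y) →
    ∀ {b u} → InBminus K b → InBplus K u → Y ≈ᴹ (u ⊙ permMat K ρ ᵀ) ⊙ b → InEπ K ρ (X , Y)
  InEπ-of-Y-cell {m} {n} ρ {X} {Y} (lowXY , upYX) {b} {u}
                 (lowb , b⁻ , bb⁻≈I , b⁻b≈I) (upu , u⁻ , uu⁻≈I , u⁻u≈I) Y≈ =
    Closure-resp (Xₐ-diagonal , ≈ᴹ.refl)
      (torus-family⊆Closure Xₐ-polynomial (PolynomialFamily-const Y)
                             (λ a a∈T → Xₐ-inE a , Xₐ-cell a a∈T) diagonal)
    where
    open ≈ᴹ-Reasoning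
    σ = permMat K ρ

    lowb⁻ : Lower b⁻
    lowb⁻ = Lower-inverse lowb bb⁻≈I b⁻b≈I

    upu⁻ : Upper u⁻
    upu⁻ = Upper-inverse upu uu⁻≈I u⁻u≈I

    W : Matrix m n
    W = (b ⊙ X) ⊙ u

    uσᵀ≈Yb⁻ : u ⊙ σ ᵀ ≈ᴹ Y ⊙ b⁻
    uσᵀ≈Yb⁻ = ≈ᴹ.sym (≈ᴹ.trans (⊙-congʳ b⁻ Y≈) (⊙-cancelʳ (u ⊙ σ ᵀ) b b⁻ bb⁻≈I))

    σᵀb≈u⁻Y : σ ᵀ ⊙ b ≈ᴹ u⁻ ⊙ Y
    σᵀb≈u⁻Y = ≈ᴹ.sym (≈ᴹ.trans (⊙-congˡ u⁻ (≈ᴹ.trans Y≈ (⊙-assoc u (σ ᵀ) b)))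
                               (⊙-cancelˡ u⁻ u (σ ᵀ ⊙ b) u⁻u≈I))

    lowWσᵀ : Lower (W ⊙ σ ᵀ)
    lowWσᵀ = Lower-resp (≈ᴹ.sym Wσᵀ≈) (Lower-⊙ lowb (Lower-⊙ lowXY lowb⁻))
      where
      Wσᵀ≈ : W ⊙ σ ᵀ ≈ᴹ b ⊙ ((X ⊙ Y) ⊙ b⁻)
      Wσᵀ≈ = begin
        ((b ⊙ X) ⊙ u) ⊙ σ ᵀ    ≈⟨ ⊙-assoc (b ⊙ X) u (σ ᵀ) ⟩
        (b ⊙ X) ⊙ (u ⊙ σ ᵀ)    ≈⟨ ⊙-congˡ (b ⊙ X) uσᵀ≈Yb⁻ ⟩
        (b ⊙ X) ⊙ (Y ⊙ b⁻)     ≈⟨ ⊙-assoc b X (Y ⊙ b⁻) ⟩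
        b ⊙ (X ⊙ (Y ⊙ b⁻))     ≈⟨ ⊙-congˡ b (⊙-assoc X Y b⁻) ⟨
        b ⊙ ((X ⊙ Y) ⊙ b⁻)     ∎

    upσᵀW : Upper (σ ᵀ ⊙ W)
    upσᵀW = Upper-resp (≈ᴹ.sym σᵀW≈) (Upper-⊙ upu⁻ (Upper-⊙ upYX upu))
      where
      σᵀW≈ : σ ᵀ ⊙ W ≈ᴹ u⁻ ⊙ ((Y ⊙ X) ⊙ u)
      σᵀW≈ = begin
        σ ᵀ ⊙ ((b ⊙ X) ⊙ u)    ≈⟨ ⊙-assoc (σ ᵀ) (b ⊙ X) u ⟨
        (σ ᵀ ⊙ (b ⊙ X)) ⊙ u    ≈⟨ ⊙-congʳ u (⊙-assoc (σ ᵀ) b X) ⟨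
        ((σ ᵀ ⊙ b) ⊙ X) ⊙ u    ≈⟨ ⊙-congʳ u (⊙-congʳ X σᵀb≈u⁻Y) ⟩
        ((u⁻ ⊙ Y) ⊙ X) ⊙ u     ≈⟨ ⊙-congʳ u (⊙-assoc u⁻ Y X) ⟩
        (u⁻ ⊙ (Y ⊙ X)) ⊙ u     ≈⟨ ⊙-assoc u⁻ (Y ⊙ X) u ⟩
        u⁻ ⊙ ((Y ⊙ X) ⊙ u)     ∎

    open TorusFamily ρ W lowWσᵀ upσᵀW

    Xₐ : Point m → Matrix m n
    Xₐ a = (b⁻ ⊙ Wₐ a) ⊙ u⁻

    Xₐ-polynomial : PolynomialFamily m Xₐ
    Xₐ-polynomial = PolynomialFamily-⊙ (PolynomialFamily-⊙ (PolynomialFamily-const b⁻) Wₐ-polynomial)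
                                       (PolynomialFamily-const u⁻)

    Xₐ-diagonal : Xₐ diagonal ≈ᴹ X
    Xₐ-diagonal = begin
      (b⁻ ⊙ Wₐ diagonal) ⊙ u⁻     ≈⟨ ⊙-congʳ u⁻ (⊙-congˡ b⁻ Wₐ-diagonal) ⟩
      (b⁻ ⊙ ((b ⊙ X) ⊙ u)) ⊙ u⁻   ≈⟨ ⊙-congʳ u⁻ (⊙-assoc b⁻ (b ⊙ X) u) ⟨
      ((b⁻ ⊙ (b ⊙ X)) ⊙ u) ⊙ u⁻   ≈⟨ ⊙-congʳ u⁻ (⊙-congʳ u (⊙-cancelˡ b⁻ b X b⁻b≈I)) ⟩
      (X ⊙ u) ⊙ u⁻                ≈⟨ ⊙-cancelʳ X u u⁻ uu⁻≈I ⟩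
      X                           ∎

    Xₐ-inE : ∀ a → InE K (Xₐ a , Y)
    Xₐ-inE a = Lower-resp (≈ᴹ.sym XₐY≈) (Lower-⊙ lowb⁻ (Lower-⊙ (B-lower a) lowb))
             , Upper-resp (≈ᴹ.sym YXₐ≈) (Upper-⊙ upu (Upper-⊙ (Upper-σᵀ⊙Wₐ a) upu⁻))
      where
      XₐY≈ : Xₐ a ⊙ Y ≈ᴹ b⁻ ⊙ (B a ⊙ b)
      XₐY≈ = begin
        ((b⁻ ⊙ Wₐ a) ⊙ u⁻) ⊙ Y
          ≈⟨ ⊙-congˡ ((b⁻ ⊙ Wₐ a) ⊙ u⁻) (≈ᴹ.trans Y≈ (⊙-assoc u (σ ᵀ) b)) ⟩
        ((b⁻ ⊙ Wₐ a) ⊙ u⁻) ⊙ (u ⊙ (σ ᵀ ⊙ b))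
          ≈⟨ ⊙-cancel-middle (b⁻ ⊙ Wₐ a) u⁻ u (σ ᵀ ⊙ b) u⁻u≈I ⟩
        (b⁻ ⊙ Wₐ a) ⊙ (σ ᵀ ⊙ b)
          ≈⟨ ⊙-assoc b⁻ (Wₐ a) (σ ᵀ ⊙ b) ⟩
        b⁻ ⊙ (Wₐ a ⊙ (σ ᵀ ⊙ b))
          ≈⟨ ⊙-congˡ b⁻ (⊙-assoc (Wₐ a) (σ ᵀ) b) ⟨
        b⁻ ⊙ ((Wₐ a ⊙ σ ᵀ) ⊙ b)
          ≈⟨ ⊙-congˡ b⁻ (⊙-congʳ b (Wₐ⊙σᵀ a)) ⟩
        b⁻ ⊙ (B a ⊙ b)                        ∎
      YXₐ≈ : Y ⊙ Xₐ a ≈ᴹ u ⊙ ((σ ᵀ ⊙ Wₐ a) ⊙ u⁻)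
      YXₐ≈ = begin
        Y ⊙ ((b⁻ ⊙ Wₐ a) ⊙ u⁻)                ≈⟨ ⊙-congʳ ((b⁻ ⊙ Wₐ a) ⊙ u⁻) Y≈ ⟩
        ((u ⊙ σ ᵀ) ⊙ b) ⊙ ((b⁻ ⊙ Wₐ a) ⊙ u⁻)  ≈⟨ ⊙-congˡ ((u ⊙ σ ᵀ) ⊙ b) (⊙-assoc b⁻ (Wₐ a) u⁻) ⟩
        ((u ⊙ σ ᵀ) ⊙ b) ⊙ (b⁻ ⊙ (Wₐ a ⊙ u⁻))  ≈⟨ ⊙-cancel-middle (u ⊙ σ ᵀ) b b⁻ (Wₐ a ⊙ u⁻) bb⁻≈I ⟩
        (u ⊙ σ ᵀ) ⊙ (Wₐ a ⊙ u⁻)               ≈⟨ ⊙-assoc u (σ ᵀ) (Wₐ a ⊙ u⁻) ⟩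
        u ⊙ (σ ᵀ ⊙ (Wₐ a ⊙ u⁻))               ≈⟨ ⊙-congˡ u (⊙-assoc (σ ᵀ) (Wₐ a) u⁻) ⟨
        u ⊙ ((σ ᵀ ⊙ Wₐ a) ⊙ u⁻)               ∎

    Xₐ-cell : ∀ a → Torus a → InCell K ρ (Xₐ a)
    Xₐ-cell a a∈T = InCell-⊙ {π = ρ} (lowb⁻ , b , b⁻b≈I , bb⁻≈I) (Wₐ-cell a a∈T) (upu⁻ , u , u⁻u≈I , uu⁻≈I)

  InEπ-ι : ∀ {m n} (π : PPerm m n) (p : Pt K m n) → InEπ K π p → InEπ K (γπγ π) (ι K p)
  InEπ-ι π = Closure-ι ιcell⊆Ē
    where
    open Involution K
    ιcell⊆Ē : ∀ q → InECell π q → InEπ K (γπγ π) (ι K q)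
    ιcell⊆Ē (X , Y) (XY∈E , b , u , b∈B₋ , u∈B₊ , X≈bπu) =
      Closure-resp (≈ₚ-sym (ι-antitranspose X Y))
        (InEπ-of-Y-cell (γπγ π) (InE-antitranspose XY∈E)
          (InBminus-antitranspose b∈B₋) (InBplus-antitranspose u∈B₊) X̃≈)
      where
      open ≈ᴹ-Reasoning
      P = permMat K π
      X̃≈ : antitranspose X ≈ᴹ (antitranspose u ⊙ permMat K (γπγ π) ᵀ) ⊙ antitranspose b
      X̃≈ = begin
        antitranspose X
          ≈⟨ antitranspose-cong X≈bπu ⟩
        antitranspose ((b ⊙ P) ⊙ u)
          ≈⟨ antitranspose-⊙ (b ⊙ P) u ⟩
        antitranspose u ⊙ antitranspose (b ⊙ P)
          ≈⟨ ⊙-congˡ (antitranspose u) (antitranspose-⊙ b P) ⟩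
        antitranspose u ⊙ (antitranspose P ⊙ antitranspose b)
          ≈⟨ ⊙-assoc (antitranspose u) (antitranspose P) (antitranspose b) ⟨
        (antitranspose u ⊙ antitranspose P) ⊙ antitranspose b
          ≈⟨ ⊙-congʳ (antitranspose b) (⊙-congˡ (antitranspose u) (permMat-antitranspose π)) ⟩
        (antitranspose u ⊙ permMat K (γπγ π) ᵀ) ⊙ antitranspose b ∎

  InEπ-ι-surjective : ∀ {m n} (π : PPerm m n) (q : Pt K m n) → InEπ K (γπγ π) q →
    ∃ λ p → InEπ K π p × _≈ₚ_ K (ι K p) q
  InEπ-ι-surjective π q q∈Ē = ι K q ,
    Closure-mono (λ _ → InECell-cong) (ι K q) (InEπ-ι (γπγ π) q q∈Ē) ,
    Involution.ι-involutive K q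
    where
    γπγ-involutive : ∀ i → fun (γπγ (γπγ π)) i ≡ fun π i
    γπγ-involutive i = ≡.trans (Fin.opposite-involutive _) (≡.cong (fun π) (Fin.opposite-involutive i))
    InECell-cong : ∀ {p} → InECell (γπγ (γπγ π)) p → InECell π p
    InECell-cong (p∈E , b , u , b∈B₋ , u∈B₊ , X≈) =
      p∈E , b , u , b∈B₋ , u∈B₊ ,
      ≈ᴹ.trans X≈ (⊙-congʳ u (⊙-congˡ b (permMat-cong (γπγ (γπγ π)) π γπγ-involutive)))

lemma2p6 : ∀ {c ℓ : Level} (K : ACF0 c ℓ) (m n : ℕ) → 1 ≤ m → m ≤ n →
    (∀ (p : Pt K m n) → _≈ₚ_ K (ι K (ι K p)) p)
    × (∀ (p : Pt K m n) → InE K p → InE K (ι K p))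
    × (∀ (π : PPerm m n) →
        (∀ (p : Pt K m n) → InEπ K π p → InEπ K (γπγ π) (ι K p))
        × (∀ (q : Pt K m n) → InEπ K (γπγ π) q →
             ∃ λ (p : Pt K m n) → InEπ K π p × _≈ₚ_ K (ι K p) q))
lemma2p6 K m n _ _ =
  Involution.ι-involutive K ,
  Involution.InE-ι K ,
  λ π → CellClosure.InEπ-ι K π , CellClosure.InEπ-ι-surjective K π
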